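{- For each ground type $\gamma$ there is a TD-poly-cost $S_1^-$ function $\mathrm{deserialize}_\gamma:\mathsf{vtg}\to\gamma$ such that whenever $(\Gamma\vdash e:\mathsf{vtg})\theta$ evaluates to a $\mathsf{vtg}$-value $L$ that represents a type-$\gamma$ value $v$, then $(\Gamma\vdash\mathrm{deserialize}_\gamma(e):\gamma)\theta$ evaluates to $v$.
   Context: $S_1^-$ is a first-order call-by-value typed $\lambda$-calculus with ground types built from $\mathsf{unit}$ and inductive data types $\mu P$ ($P$ a polynomial functor from $\mathrm{Id}$, constant functors, $+,\times$; $\mu P$ its nonempty least fixed point) by $+,\times$; terms: $\lambda$, application, pairs/projections, injections/case, constructors $\mathsf c_{\mu P}$, destructors $\mathsf d_{\mu P}$, structural recursion $\mathsf{fold}_{\mu P}$. Values are rooted labelled dags (vertices $\underline{()}$, $\underline\iota_j$, pair, $\underline{\mathsf c}_{\mu P}$) with sharing; $\mathrm{size}(v)$ = number of $\underline{\mathsf c}_{\mu P}$ vertices. Closures $e\theta$ pair a typed term with an environment assigning values to its free variables. Under the top-down (TD) semantics (standard big-step call-by-value, folds recursing top-down), the TD-cost of an evaluation is the number of nodes of its derivation tree; a closed $f:\gamma_1\to\gamma_0$ is TD-poly-cost iff its TD-cost on input value $v$ is bounded by a polynomial in $\mathrm{size}(v)$. $\mathsf{vtg}=\mathsf{list}_{\mathsf{vertex}}$ where $\mathsf{vertex}$ has constructors $\mathsf{Vert}_{()}$, $\mathsf{Vert}_{\iota_1},\mathsf{Vert}_{\iota_2}$ of $\mathsf{string}\times\mathsf{nat}$,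 $\mathsf{Vert}_{(,)}$ of $\mathsf{string}\times\mathsf{nat}\times\mathsf{nat}$, $\mathsf{Vert}_\mu$ of $\mathsf{string}\times\mathsf{nat}$, with $\ulcorner\gamma\urcorner$ a fixed string encoding of type $\gamma$. For $L=[u_{n-1},\dots,u_0]$, $u_i$ has address $i$; $L$ represents $v$ iff there is a bijection between vertices of $v$ and items of $L$ with: $\underline{()}\mapsto\mathsf{Vert}_{()}$; a pair vertex of type $\gamma_1\times\gamma_2$ with children $v_1,v_2\mapsto\mathsf{Vert}_{(,)}(\ulcorner\gamma_1\times\gamma_2\urcorner,a_1,a_2)$ ($a_j$ the address of $v_j$'s item); an $\underline\iota_j$-vertex of type $\gamma_1+\gamma_2$ with child $v_j\mapsto\mathsf{Vert}_{\iota_j}(\ulcorner\gamma_1+\gamma_2\urcorner,a_j)$; a $\underline{\mathsf c}_{\mu P}$-vertex with child $v_0\mapsto\mathsf{Vert}_\mu(\ulcorner\mu P\urcorner,a_0)$; and the item order is a topological sort of $v$. -}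

module Defs where

open import Data.Bool using (Bool; true; false; T; _∨_; _∧_)
open import Data.Unit using (⊤; tt)
open import Data.Nat using (ℕ; zero; suc; _+_; _*_; _^_; _≤_; _<_)
open import Data.List using (List; []; _∷_; _++_; length; reverse)
open import Data.List.Membership.Propositional using (_∈_)
open import Data.List.Relation.Unary.Any using (here; there)
open import Data.List.Relation.Unary.All using (All; []; _∷_)
import Data.List.Relation.Unary.All as All
open import Data.List.Relation.Unary.Unique.Propositional using (Unique)
open import Data.Maybe using (Maybe; just; nothing)
open import Data.Product using (Σ; ∃; _×_; _,_)
open import Relation.Binary.PropositionalEquality using (_≡_; refl)

-- Ground types and polynomial functors (induction-recursion: μP is only
-- formed when P has a base case, i.e. μP is nonempty).

infixr 5 _⊕_ _⊕P_
infixr 6 _⊗_ _⊗P_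

mutual
  data Ty : Set where
    unit : Ty
    _⊕_  : Ty → Ty → Ty
    _⊗_  : Ty → Ty → Ty
    μ    : (P : Poly) → T (base P) → Ty

  data Poly : Set where
    Id   : Poly
    K    : Ty → Poly
    _⊕P_ : Poly → Poly → Poly
    _⊗P_ : Poly → Poly → Poly

  -- base P = true iff P(∅) is nonempty (all ground types being nonempty)
  base : Poly → Bool
  base Id         = false
  base (K _)      = true
  base (P ⊕P Q)   = base P ∨ base Q
  base (P ⊗P Q)   = base P ∧ base Q

_⟦_⟧ : Poly → Ty → Ty
Id       ⟦ γ ⟧ = γ
K δ      ⟦ γ ⟧ = δ
(P ⊕P Q) ⟦ γ ⟧ = P ⟦ γ ⟧ ⊕ Q ⟦ γ ⟧
(P ⊗P Q) ⟦ γ ⟧ = P ⟦ γ ⟧ ⊗ Q ⟦ γ ⟧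

boolT : Ty
boolT = unit ⊕ unit

natT : Ty
natT = μ (K unit ⊕P Id) tt

stringT : Ty
stringT = μ (K unit ⊕P (K boolT ⊗P Id)) tt

vertexT : Ty
vertexT = μ ( K unit                              -- Vert_()
            ⊕P K (stringT ⊗ natT)                 -- Vert_ι1
            ⊕P K (stringT ⊗ natT)                 -- Vert_ι2
            ⊕P K (stringT ⊗ (natT ⊗ natT))        -- Vert_(,)
            ⊕P K (stringT ⊗ natT)) tt             -- Vert_μ

vtg : Ty
vtg = μ (K unit ⊕P (K vertexT ⊗P Id)) tt

-- fixed (prefix-free, injective) string encoding ⌜γ⌝ of types
mutual
  enc : Ty → List Bool
  enc unit      = false ∷ false ∷ false ∷ []
  enc (a ⊕ b)   = false ∷ false ∷ true ∷ enc a ++ enc b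
  enc (a ⊗ b)   = false ∷ true ∷ false ∷ enc a ++ enc b
  enc (μ P _)   = false ∷ true ∷ true ∷ encP P

  encP : Poly → List Bool
  encP Id       = true ∷ false ∷ false ∷ []
  encP (K a)    = true ∷ false ∷ true ∷ enc a
  encP (P ⊕P Q) = true ∷ true ∷ false ∷ encP P ++ encP Q
  encP (P ⊗P Q) = true ∷ true ∷ true ∷ encP P ++ encP Q

Ctx : Set
Ctx = List Ty

mutual
  data Tm (Γ : Ctx) : Ty → Set where
    var  : ∀ {a} → a ∈ Γ → Tm Γ a
    ⟨⟩   : Tm Γ unit
    pair : ∀ {a b} → Tm Γ a → Tm Γ b → Tm Γ (a ⊗ b)
    fst  : ∀ {a b} → Tm Γ (a ⊗ b) → Tm Γ a
    snd  : ∀ {a b} → Tm Γ (a ⊗ b) → Tm Γ b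
    inl  : ∀ {a b} → Tm Γ a → Tm Γ (a ⊕ b)
    inr  : ∀ {a b} → Tm Γ b → Tm Γ (a ⊕ b)
    case : ∀ {a b c} → Tm Γ (a ⊕ b) → Tm (a ∷ Γ) c → Tm (b ∷ Γ) c → Tm Γ c
    con  : ∀ P (w : T (base P)) → Tm Γ (P ⟦ μ P w ⟧) → Tm Γ (μ P w)
    des  : ∀ P (w : T (base P)) → Tm Γ (μ P w) → Tm Γ (P ⟦ μ P w ⟧)
    app  : ∀ {a c} → Fun Γ a c → Tm Γ a → Tm Γ c
    fold : ∀ P (w : T (base P)) {c} → Fun Γ (P ⟦ c ⟧) c → Tm Γ (μ P w) → Tm Γ c

  data Fun (Γ : Ctx) (a c : Ty) : Set where
    lam : Tm (a ∷ Γ) c → Fun Γ a c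

Ren : Ctx → Ctx → Set
Ren Γ Δ = ∀ {a} → a ∈ Γ → a ∈ Δ

ext : ∀ {Γ Δ b} → Ren Γ Δ → Ren (b ∷ Γ) (b ∷ Δ)
ext ρ (here p)  = here p
ext ρ (there x) = there (ρ x)

mutual
  ren : ∀ {Γ Δ a} → Ren Γ Δ → Tm Γ a → Tm Δ a
  ren ρ (var x)        = var (ρ x)
  ren ρ ⟨⟩             = ⟨⟩
  ren ρ (pair s t)     = pair (ren ρ s) (ren ρ t)
  ren ρ (fst t)        = fst (ren ρ t)
  ren ρ (snd t)        = snd (ren ρ t)
  ren ρ (inl t)        = inl (ren ρ t)
  ren ρ (inr t)        = inr (ren ρ t)
  ren ρ (case t l r)   = case (ren ρ t) (ren (ext ρ) l) (ren (ext ρ) r)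
  ren ρ (con P w t)    = con P w (ren ρ t)
  ren ρ (des P w t)    = des P w (ren ρ t)
  ren ρ (app f t)      = app (renF ρ f) (ren ρ t)
  ren ρ (fold P w f t) = fold P w (renF ρ f) (ren ρ t)

  renF : ∀ {Γ Δ a c} → Ren Γ Δ → Fun Γ a c → Fun Δ a c
  renF ρ (lam t) = lam (ren (ext ρ) t)

wkFun : ∀ {Γ a c} → Fun [] a c → Fun Γ a c
wkFun = renF (λ ())

-- Values: rooted labelled dags with sharing, living in a heap.
-- A heap is a list of vertices; vertex i is at address i; children are
-- addresses.  A value is a pair (heap, root address).

data Node : Set where
  nUnit : Node
  nInl  : Ty → ℕ → Node        -- label: the sum type γ1 + γ2
  nInr  : Ty → ℕ → Node
  nPair : Ty → ℕ → ℕ → Node    -- label: the product type γ1 × γ2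
  nCon  : Ty → ℕ → Node        -- label: the type μP

Heap : Set
Heap = List Node

nth : ∀ {A : Set} → List A → ℕ → Maybe A
nth []       _       = nothing
nth (x ∷ xs) zero    = just x
nth (x ∷ xs) (suc n) = nth xs n

alloc : Heap → Node → Heap
alloc H n = H ++ n ∷ []

children : Node → List ℕ
children nUnit         = []
children (nInl _ c)    = c ∷ []
children (nInr _ c)    = c ∷ []
children (nPair _ c d) = c ∷ d ∷ []
children (nCon _ c)    = c ∷ []

data Reach (H : Heap) (p : ℕ) : ℕ → Set where
  root : Reach H p p
  step : ∀ {q n c} → Reach H p q → nth H q ≡ just n → c ∈ children n → Reach H p c

data WT (H : Heap) : ℕ → Ty → Set where
  wtUnit : ∀ {p} → nth H p ≡ just nUnit → WT H p unit
  wtInl  : ∀ {p c a b} → nth H p ≡ just (nInl (a ⊕ b) c) → WT H c a → WT H p (a ⊕ b)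
  wtInr  : ∀ {p c a b} → nth H p ≡ just (nInr (a ⊕ b) c) → WT H c b → WT H p (a ⊕ b)
  wtPair : ∀ {p c d a b} → nth H p ≡ just (nPair (a ⊗ b) c d) → WT H c a → WT H d b → WT H p (a ⊗ b)
  wtCon  : ∀ {p c P w} → nth H p ≡ just (nCon (μ P w) c) → WT H c (P ⟦ μ P w ⟧) → WT H p (μ P w)

Env : Ctx → Set
Env Γ = All (λ _ → ℕ) Γ

EnvWT : ∀ {Γ} → Heap → Env Γ → Set
EnvWT {Γ} H θ = ∀ {a} (x : a ∈ Γ) → WT H (All.lookup θ x) a

IsCon : Heap → ℕ → Set
IsCon H q = Σ Ty λ γ → Σ ℕ λ c → nth H q ≡ just (nCon γ c)

Size : Heap → ℕ → ℕ → Set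
Size H p s = Σ (List ℕ) λ xs → Unique xs
           × (∀ q → q ∈ xs → Reach H p q × IsCon H q)
           × (∀ q → Reach H p q → IsCon H q → q ∈ xs)
           × length xs ≡ s

data NodeMap (φ : ℕ → ℕ) : Maybe Node → Maybe Node → Set where
  mUnit : NodeMap φ (just nUnit) (just nUnit)
  mInl  : ∀ {γ c} → NodeMap φ (just (nInl γ c)) (just (nInl γ (φ c)))
  mInr  : ∀ {γ c} → NodeMap φ (just (nInr γ c)) (just (nInr γ (φ c)))
  mPair : ∀ {γ c d} → NodeMap φ (just (nPair γ c d)) (just (nPair γ (φ c) (φ d)))
  mCon  : ∀ {γ c} → NodeMap φ (just (nCon γ c)) (just (nCon γ (φ c)))

-- equality of values = isomorphism of rooted labelled dags
Iso : Heap → ℕ → Heap → ℕ → Set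
Iso H p H' p' = Σ (ℕ → ℕ) λ φ →
    φ p ≡ p'
  × (∀ q → Reach H p q → Reach H' p' (φ q))
  × (∀ q q' → Reach H p q → Reach H p q' → φ q ≡ φ q' → q ≡ q')
  × (∀ r → Reach H' p' r → Σ ℕ λ q → Reach H p q × φ q ≡ r)
  × (∀ q → Reach H p q → NodeMap φ (nth H q) (nth H' (φ q)))

-- TD (top-down) big-step call-by-value semantics with cost
-- Eval H θ e H' p n : e under θ (in heap H) evaluates to the value (H' , p)
-- and n is the number of nodes of the derivation tree.

mutual
  data Eval {Γ : Ctx} : ∀ {a} → Heap → Env Γ → Tm Γ a → Heap → ℕ → ℕ → Set where
    eVar  : ∀ {a H θ} {x : a ∈ Γ} → Eval H θ (var x) H (All.lookup θ x) 1
    eUnit : ∀ {H θ} → Eval H θ ⟨⟩ (alloc H nUnit) (length H) 1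
    ePair : ∀ {a b H θ H1 H2 p1 p2 n1 n2} {s : Tm Γ a} {t : Tm Γ b} →
            Eval H θ s H1 p1 n1 → Eval H1 θ t H2 p2 n2 →
            Eval H θ (pair s t) (alloc H2 (nPair (a ⊗ b) p1 p2)) (length H2) (suc (n1 + n2))
    eFst  : ∀ {a b H θ H1 p γ p1 p2 n} {t : Tm Γ (a ⊗ b)} →
            Eval H θ t H1 p n → nth H1 p ≡ just (nPair γ p1 p2) →
            Eval H θ (fst t) H1 p1 (suc n)
    eSnd  : ∀ {a b H θ H1 p γ p1 p2 n} {t : Tm Γ (a ⊗ b)} →
            Eval H θ t H1 p n → nth H1 p ≡ just (nPair γ p1 p2) →
            Eval H θ (snd t) H1 p2 (suc n)
    eInl  : ∀ {a b H θ H1 p n} {t : Tm Γ a} →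
            Eval H θ t H1 p n →
            Eval H θ (inl {b = b} t) (alloc H1 (nInl (a ⊕ b) p)) (length H1) (suc n)
    eInr  : ∀ {a b H θ H1 p n} {t : Tm Γ b} →
            Eval H θ t H1 p n →
            Eval H θ (inr {a = a} t) (alloc H1 (nInr (a ⊕ b) p)) (length H1) (suc n)
    eCaseL : ∀ {a b c H θ H1 H2 p γ q r n m} {t : Tm Γ (a ⊕ b)} {l : Tm (a ∷ Γ) c} {k : Tm (b ∷ Γ) c} →
            Eval H θ t H1 p n → nth H1 p ≡ just (nInl γ q) →
            Eval H1 (q ∷ θ) l H2 r m →
            Eval H θ (case t l k) H2 r (suc (n + m))
    eCaseR : ∀ {a b c H θ H1 H2 p γ q r n m} {t : Tm Γ (a ⊕ b)} {l : Tm (a ∷ Γ) c} {k : Tm (b ∷ Γ) c} →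
            Eval H θ t H1 p n → nth H1 p ≡ just (nInr γ q) →
            Eval H1 (q ∷ θ) k H2 r m →
            Eval H θ (case t l k) H2 r (suc (n + m))
    eCon  : ∀ {P w H θ H1 p n} {t : Tm Γ (P ⟦ μ P w ⟧)} →
            Eval H θ t H1 p n →
            Eval H θ (con P w t) (alloc H1 (nCon (μ P w) p)) (length H1) (suc n)
    eDes  : ∀ {P w H θ H1 p γ q n} {t : Tm Γ (μ P w)} →
            Eval H θ t H1 p n → nth H1 p ≡ just (nCon γ q) →
            Eval H θ (des P w t) H1 q (suc n)
    eApp  : ∀ {a c H θ H1 H2 p r n m} {body : Tm (a ∷ Γ) c} {t : Tm Γ a} →
            Eval H θ t H1 p n → Eval H1 (p ∷ θ) body H2 r m →
            Eval H θ (app (lam body) t) H2 r (suc (n + m))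
    eFold : ∀ {P w c H θ H1 H2 p r n m} {body : Tm (P ⟦ c ⟧ ∷ Γ) c} {t : Tm Γ (μ P w)} →
            Eval H θ t H1 p n → FoldEval θ P body H1 p H2 r m →
            Eval H θ (fold P w (lam body) t) H2 r (suc (n + m))

  data FoldEval {Γ : Ctx} (θ : Env Γ) (P : Poly) {c : Ty} (body : Tm (P ⟦ c ⟧ ∷ Γ) c)
       : Heap → ℕ → Heap → ℕ → ℕ → Set where
    fStep : ∀ {H H1 H2 p γ q q' r m1 m2} →
            nth H p ≡ just (nCon γ q) →
            MapEval θ P body P H q H1 q' m1 →
            Eval H1 (q' ∷ θ) body H2 r m2 →
            FoldEval θ P body H p H2 r (suc (m1 + m2))

  -- the functorial action Q(fold f) for sub-functors Q of P
  data MapEval {Γ : Ctx} (θ : Env Γ) (P : Poly) {c : Ty} (body : Tm (P ⟦ c ⟧ ∷ Γ) c)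
       : Poly → Heap → ℕ → Heap → ℕ → ℕ → Set where
    mId   : ∀ {H H1 q r m} → FoldEval θ P body H q H1 r m →
            MapEval θ P body Id H q H1 r (suc m)
    mK    : ∀ {δ H q} → MapEval θ P body (K δ) H q H q 1
    mInl  : ∀ {Q1 Q2 H H1 q γ q1 r m} → nth H q ≡ just (nInl γ q1) →
            MapEval θ P body Q1 H q1 H1 r m →
            MapEval θ P body (Q1 ⊕P Q2) H q (alloc H1 (nInl (Q1 ⟦ c ⟧ ⊕ Q2 ⟦ c ⟧) r)) (length H1) (suc m)
    mInr  : ∀ {Q1 Q2 H H1 q γ q2 r m} → nth H q ≡ just (nInr γ q2) →
            MapEval θ P body Q2 H q2 H1 r m →
            MapEval θ P body (Q1 ⊕P Q2) H q (alloc H1 (nInr (Q1 ⟦ c ⟧ ⊕ Q2 ⟦ c ⟧) r)) (length H1) (suc m)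
    mPair : ∀ {Q1 Q2 H H1 H2 q γ q1 q2 r1 r2 m1 m2} → nth H q ≡ just (nPair γ q1 q2) →
            MapEval θ P body Q1 H q1 H1 r1 m1 →
            MapEval θ P body Q2 H1 q2 H2 r2 m2 →
            MapEval θ P body (Q1 ⊗P Q2) H q (alloc H2 (nPair (Q1 ⟦ c ⟧ ⊗ Q2 ⟦ c ⟧) r1 r2)) (length H2) (suc (m1 + m2))

TDPolyCost : ∀ {a c} → Fun [] a c → Set
TDPolyCost {a} f = Σ ℕ λ k → Σ ℕ λ d →
  ∀ H p s → WT H p a → Size H p s →
  ∀ H' r n → Eval {a ∷ []} H (p ∷ []) (app (wkFun f) (var (here refl))) H' r n →
  n ≤ k * (suc s) ^ d

-- vtg values read back as lists of items

data Item : Set where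
  vUnit : Item
  vInl  : List Bool → ℕ → Item
  vInr  : List Bool → ℕ → Item
  vPair : List Bool → ℕ → ℕ → Item
  vMu   : List Bool → ℕ → Item

data DecNat (H : Heap) : ℕ → ℕ → Set where
  dZero : ∀ {p γ δ q u} → nth H p ≡ just (nCon γ q) → nth H q ≡ just (nInl δ u) → DecNat H p zero
  dSuc  : ∀ {p γ δ q u n} → nth H p ≡ just (nCon γ q) → nth H q ≡ just (nInr δ u) →
          DecNat H u n → DecNat H p (suc n)

data DecBool (H : Heap) : ℕ → Bool → Set where
  dFalse : ∀ {p γ u} → nth H p ≡ just (nInl γ u) → DecBool H p false
  dTrue  : ∀ {p γ u} → nth H p ≡ just (nInr γ u) → DecBool H p true

data DecStr (H : Heap) : ℕ → List Bool → Set where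
  dNil  : ∀ {p γ δ q u} → nth H p ≡ just (nCon γ q) → nth H q ≡ just (nInl δ u) → DecStr H p []
  dCons : ∀ {p γ δ ε q u x s b bs} → nth H p ≡ just (nCon γ q) → nth H q ≡ just (nInr δ u) →
          nth H u ≡ just (nPair ε x s) → DecBool H x b → DecStr H s bs → DecStr H p (b ∷ bs)

data DecSN (H : Heap) : ℕ → List Bool → ℕ → Set where
  dSN : ∀ {p γ s a str n} → nth H p ≡ just (nPair γ s a) → DecStr H s str → DecNat H a n → DecSN H p str n

data DecVertex (H : Heap) : ℕ → Item → Set where
  dVUnit : ∀ {p γ δ q u} → nth H p ≡ just (nCon γ q) → nth H q ≡ just (nInl δ u) → DecVertex H p vUnit
  dVInl  : ∀ {p γ δ1 δ2 q r t s n} → nth H p ≡ just (nCon γ q) → nth H q ≡ just (nInr δ1 r) →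
           nth H r ≡ just (nInl δ2 t) → DecSN H t s n → DecVertex H p (vInl s n)
  dVInr  : ∀ {p γ δ1 δ2 δ3 q r r2 t s n} → nth H p ≡ just (nCon γ q) → nth H q ≡ just (nInr δ1 r) →
           nth H r ≡ just (nInr δ2 r2) → nth H r2 ≡ just (nInl δ3 t) → DecSN H t s n →
           DecVertex H p (vInr s n)
  dVPair : ∀ {p γ δ1 δ2 δ3 δ4 ε1 ε2 q r r2 r3 t s u a1 a2 str n1 n2} →
           nth H p ≡ just (nCon γ q) → nth H q ≡ just (nInr δ1 r) →
           nth H r ≡ just (nInr δ2 r2) → nth H r2 ≡ just (nInr δ3 r3) →
           nth H r3 ≡ just (nInl δ4 t) → nth H t ≡ just (nPair ε1 s u) →
           nth H u ≡ just (nPair ε2 a1 a2) →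
           DecStr H s str → DecNat H a1 n1 → DecNat H a2 n2 → DecVertex H p (vPair str n1 n2)
  dVMu   : ∀ {p γ δ1 δ2 δ3 δ4 q r r2 r3 t s n} → nth H p ≡ just (nCon γ q) →
           nth H q ≡ just (nInr δ1 r) → nth H r ≡ just (nInr δ2 r2) →
           nth H r2 ≡ just (nInr δ3 r3) → nth H r3 ≡ just (nInr δ4 t) → DecSN H t s n →
           DecVertex H p (vMu s n)

data DecList (H : Heap) : ℕ → List Item → Set where
  dLNil  : ∀ {p γ δ q u} → nth H p ≡ just (nCon γ q) → nth H q ≡ just (nInl δ u) → DecList H p []
  dLCons : ∀ {p γ δ ε q u x l i is} → nth H p ≡ just (nCon γ q) → nth H q ≡ just (nInr δ u) →
           nth H u ≡ just (nPair ε x l) → DecVertex H x i → DecList H l is → DecList H p (i ∷ is)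

-- For L = [u_{n-1}, …, u_0], the item with address a.
itemAt : List Item → ℕ → Maybe Item
itemAt L a = nth (reverse L) a

data Corr (φ : ℕ → ℕ) : Maybe Node → Maybe Item → Set where
  cUnit : Corr φ (just nUnit) (just vUnit)
  cInl  : ∀ {γ c} → Corr φ (just (nInl γ c)) (just (vInl (enc γ) (φ c)))
  cInr  : ∀ {γ c} → Corr φ (just (nInr γ c)) (just (vInr (enc γ) (φ c)))
  cPair : ∀ {γ c d} → Corr φ (just (nPair γ c d)) (just (vPair (enc γ) (φ c) (φ d)))
  cCon  : ∀ {γ c} → Corr φ (just (nCon γ c)) (just (vMu (enc γ) (φ c)))

Represents : Heap → ℕ → Heap → ℕ → Set
Represents HL pL H p = Σ (List Item) λ L → DecList HL pL L × Σ (ℕ → ℕ) λ φ →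
    (∀ q → Reach H p q → φ q < length L)
  × (∀ q q' → Reach H p q → Reach H p q' → φ q ≡ φ q' → q ≡ q')
  × (∀ a → a < length L → Σ ℕ λ q → Reach H p q × φ q ≡ a)
  × (∀ q → Reach H p q → Corr φ (nth H q) (itemAt L (φ q)))
  -- topological sort: every child occurs after its parent in L
  × (∀ q n c → Reach H p q → nth H q ≡ just n → c ∈ children n → φ c < φ q)

-- The deserializer folds over L = [u_{n-1}, …, u_0]. Folds recurse top-down, so the items
-- are processed in the order u_0, u_1, …, and since L is topologically sorted the children of
-- u_j are processed before u_j. The fold accumulates a table of the values built so far,
-- newest first, each injected into the sum of all vertex types of γ; u_j is built by looking
-- up its children's addresses in the table (by a second fold counting the address down) and
-- dispatching on its type label ⌜τ⌝. The last entry built, at address n-1, is the root.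
--
-- Correctness: after j items, every vertex q with φ q < j has a copy in the heap at β (φ q),
-- with β strictly increasing, so that q ↦ β (φ q) is an isomorphism onto the result.
--
-- Cost: a lookup in a table of t entries costs O(t), so the outer fold costs O(n²); and n is
-- at most the size of the input, because the n cons cells of L are distinct μ-vertices.

module Submission where

open import Defs
open import Data.Bool using (Bool; true; false; T; if_then_else_)
open import Data.Bool.Properties using (T-∨; T-∧; T-irrelevant)
import Data.Bool as Bool
open import Data.Empty using (⊥; ⊥-elim)
open import Data.List using (List; []; _∷_; _++_; length; reverse)
open import Data.List.Membership.Propositional using (_∈_)
open import Data.List.Membership.Propositional.Properties using (∈-++⁺ˡ; ∈-++⁺ʳ; ∈-++⁻)
open import Data.List.Properties using (≡-dec; ++-assoc; ++-identityʳ; length-++; reverse-++; length-reverse; unfold-reverse)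
open import Data.List.Relation.Unary.All using (All; []; _∷_)
import Data.List.Relation.Unary.All as All
open import Data.List.Relation.Unary.AllPairs using ([]; _∷_)
open import Data.List.Relation.Unary.Any using (here; there)
open import Data.List.Relation.Unary.Unique.Propositional using (Unique)
open import Data.Maybe using (Maybe; just; nothing)
open import Data.Maybe.Properties using (just-injective)
import Data.Maybe as Maybe
open import Data.Nat using (ℕ; zero; suc; _+_; _*_; _^_; _≤_; _<_; z≤n; s≤s; _≟_)
open import Data.Nat.Properties
open import Data.Nat.Tactic.RingSolver using (solve-∀)
open import Data.Product using (Σ; _×_; _,_; proj₁; proj₂)
open import Data.Sum using (_⊎_; inj₁; inj₂)
open import Data.Unit using (⊤; tt)
open import Function using (case_of_)
open import Function.Bundles using (Equivalence)
open import Relation.Binary.PropositionalEquality using (_≡_; _≢_; refl; sym; trans; cong; subst; subst₂)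
open import Relation.Nullary using (yes; no)
open import Relation.Nullary.Decidable using (map′)
open import Relation.Binary.Definitions using (DecidableEquality; tri<; tri≈; tri>)

nth-det : ∀ {A : Set} {xs : List A} {i x y} → nth xs i ≡ just x → nth xs i ≡ just y → x ≡ y
nth-det e e' = just-injective (trans (sym e) e')

nth-++ : ∀ {A : Set} (xs ys : List A) {i x} → nth xs i ≡ just x → nth (xs ++ ys) i ≡ just x
nth-++ (z ∷ xs) ys {zero}  e = e
nth-++ (z ∷ xs) ys {suc i} e = nth-++ xs ys e

nth-length-++ : ∀ {A : Set} (xs : List A) y ys → nth (xs ++ y ∷ ys) (length xs) ≡ just y
nth-length-++ []       y ys = refl
nth-length-++ (x ∷ xs) y ys = nth-length-++ xs y ys

nth-≥-length : ∀ {A : Set} (xs : List A) {i} → length xs ≤ i → nth xs i ≡ nothing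
nth-≥-length []       h       = refl
nth-≥-length (x ∷ xs) (s≤s h) = nth-≥-length xs h

nth-< : ∀ {A : Set} (xs : List A) {i x} → nth xs i ≡ just x → i < length xs
nth-< (z ∷ xs) {zero}  e = s≤s z≤n
nth-< (z ∷ xs) {suc i} e = s≤s (nth-< xs e)

nth-reverse-last : ∀ {A : Set} (x : A) xs → nth (reverse (x ∷ xs)) (length xs) ≡ just x
nth-reverse-last x xs rewrite unfold-reverse x xs =
  subst (λ i → nth (reverse xs ++ x ∷ []) i ≡ just x) (length-reverse xs) (nth-length-++ (reverse xs) x [])

nth-reverse-∷ : ∀ {A : Set} (x : A) xs {i y} → nth (reverse xs) i ≡ just y → nth (reverse (x ∷ xs)) i ≡ just y
nth-reverse-∷ x xs e rewrite unfold-reverse x xs = nth-++ (reverse xs) (x ∷ []) e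

nth-reverse-≥ : ∀ {A : Set} (xs : List A) {i} → length xs ≤ i → nth (reverse xs) i ≡ nothing
nth-reverse-≥ xs h = nth-≥-length (reverse xs) (subst (_≤ _) (sym (length-reverse xs)) h)

infix 4 _⊑_

_⊑_ : Heap → Heap → Set
H ⊑ H' = Σ Heap λ xs → H' ≡ H ++ xs

⊑-refl : ∀ {H} → H ⊑ H
⊑-refl {H} = [] , sym (++-identityʳ H)

⊑-trans : ∀ {H1 H2 H3} → H1 ⊑ H2 → H2 ⊑ H3 → H1 ⊑ H3
⊑-trans {H1} (xs , refl) (ys , refl) = xs ++ ys , ++-assoc H1 xs ys

⊑-alloc : ∀ {H n} → H ⊑ alloc H n
⊑-alloc {n = n} = n ∷ [] , refl

⊑-alloc₂ : ∀ {H a b} → H ⊑ alloc (alloc H a) b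
⊑-alloc₂ = ⊑-trans ⊑-alloc ⊑-alloc

⊑-alloc₃ : ∀ {H a b c} → H ⊑ alloc (alloc (alloc H a) b) c
⊑-alloc₃ = ⊑-trans ⊑-alloc ⊑-alloc₂

⊑-alloc₄ : ∀ {H a b c d} → H ⊑ alloc (alloc (alloc (alloc H a) b) c) d
⊑-alloc₄ = ⊑-trans ⊑-alloc ⊑-alloc₃

⊑-length : ∀ {H H'} → H ⊑ H' → length H ≤ length H'
⊑-length {H} (xs , refl) = subst (length H ≤_) (sym (length-++ H)) (m≤m+n _ _)

nth-⊑ : ∀ {H H' q n} → H ⊑ H' → nth H q ≡ just n → nth H' q ≡ just n
nth-⊑ {H} (xs , refl) e = nth-++ H xs e

nth-alloc : ∀ (H : Heap) n → nth (alloc H n) (length H) ≡ just n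
nth-alloc H n = nth-length-++ H n []

nth-alloc₁ : ∀ (H : Heap) n1 n2 → nth (alloc (alloc H n1) n2) (length H) ≡ just n1
nth-alloc₁ H n1 n2 = nth-⊑ {H = alloc H n1} ⊑-alloc (nth-alloc H n1)

nth-alloc₂ : ∀ (H : Heap) n1 n2 n3 → nth (alloc (alloc (alloc H n1) n2) n3) (length H) ≡ just n1
nth-alloc₂ H n1 n2 n3 = nth-⊑ {H = alloc H n1} ⊑-alloc₂ (nth-alloc H n1)

mutual
  eval-⊑ : ∀ {Γ a H θ} {e : Tm Γ a} {H' r n} → Eval H θ e H' r n → H ⊑ H'
  eval-⊑ eVar = ⊑-refl
  eval-⊑ eUnit = ⊑-alloc
  eval-⊑ (ePair d1 d2) = ⊑-trans (eval-⊑ d1) (⊑-trans (eval-⊑ d2) ⊑-alloc)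
  eval-⊑ (eFst d x) = eval-⊑ d
  eval-⊑ (eSnd d x) = eval-⊑ d
  eval-⊑ (eInl d) = ⊑-trans (eval-⊑ d) ⊑-alloc
  eval-⊑ (eInr d) = ⊑-trans (eval-⊑ d) ⊑-alloc
  eval-⊑ (eCaseL d x d₁) = ⊑-trans (eval-⊑ d) (eval-⊑ d₁)
  eval-⊑ (eCaseR d x d₁) = ⊑-trans (eval-⊑ d) (eval-⊑ d₁)
  eval-⊑ (eCon d) = ⊑-trans (eval-⊑ d) ⊑-alloc
  eval-⊑ (eDes d x) = eval-⊑ d
  eval-⊑ (eApp d d₁) = ⊑-trans (eval-⊑ d) (eval-⊑ d₁)
  eval-⊑ (eFold d x) = ⊑-trans (eval-⊑ d) (foldEval-⊑ x)

  foldEval-⊑ : ∀ {Γ θ P c body H p H' r m} → FoldEval {Γ} θ P {c} body H p H' r m → H ⊑ H'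
  foldEval-⊑ (fStep x x₁ x₂) = ⊑-trans (mapEval-⊑ x₁) (eval-⊑ x₂)

  mapEval-⊑ : ∀ {Γ θ P c body Q H p H' r m} → MapEval {Γ} θ P {c} body Q H p H' r m → H ⊑ H'
  mapEval-⊑ (mId x) = foldEval-⊑ x
  mapEval-⊑ mK = ⊑-refl
  mapEval-⊑ (mInl x d) = ⊑-trans (mapEval-⊑ d) ⊑-alloc
  mapEval-⊑ (mInr x d) = ⊑-trans (mapEval-⊑ d) ⊑-alloc
  mapEval-⊑ (mPair x d d₁) = ⊑-trans (mapEval-⊑ d) (⊑-trans (mapEval-⊑ d₁) ⊑-alloc)

-- Determinism of evaluation

record Outcome : Set where
  constructor outcome
  field
    heap  : Heap
    value : ℕ
    cost  : ℕ

mutual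
  eval-det : ∀ {Γ a H θ} {e : Tm Γ a} {H' r n H'' r' n'} → Eval H θ e H' r n → Eval H θ e H'' r' n' → outcome H' r n ≡ outcome H'' r' n'
  eval-det eVar eVar = refl
  eval-det eUnit eUnit = refl
  eval-det (ePair d1 d2) (ePair d1' d2') with eval-det d1 d1'
  ... | refl with eval-det d2 d2'
  ... | refl = refl
  eval-det (eFst d e) (eFst d' e') with eval-det d d'
  ... | refl with trans (sym e) e'
  ... | refl = refl
  eval-det (eSnd d e) (eSnd d' e') with eval-det d d'
  ... | refl with trans (sym e) e'
  ... | refl = refl
  eval-det (eInl d) (eInl d') with eval-det d d'
  ... | refl = refl
  eval-det (eInr d) (eInr d') with eval-det d d'
  ... | refl = refl
  eval-det (eCaseL d e d2) (eCaseL d' e' d2') with eval-det d d'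
  ... | refl with trans (sym e) e'
  ... | refl with eval-det d2 d2'
  ... | refl = refl
  eval-det (eCaseL d e d2) (eCaseR d' e' d2') with eval-det d d'
  ... | refl with trans (sym e) e'
  ... | ()
  eval-det (eCaseR d e d2) (eCaseL d' e' d2') with eval-det d d'
  ... | refl with trans (sym e) e'
  ... | ()
  eval-det (eCaseR d e d2) (eCaseR d' e' d2') with eval-det d d'
  ... | refl with trans (sym e) e'
  ... | refl with eval-det d2 d2'
  ... | refl = refl
  eval-det (eCon d) (eCon d') with eval-det d d'
  ... | refl = refl
  eval-det (eDes d e) (eDes d' e') with eval-det d d'
  ... | refl with trans (sym e) e'
  ... | refl = refl
  eval-det (eApp d d2) (eApp d' d2') with eval-det d d'
  ... | refl with eval-det d2 d2'
  ... | refl = refl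
  eval-det (eFold d f) (eFold d' f') with eval-det d d'
  ... | refl with foldEval-det f f'
  ... | refl = refl

  foldEval-det : ∀ {Γ θ P c body H p H' r m H'' r' m'} → FoldEval {Γ} θ P {c} body H p H' r m → FoldEval θ P body H p H'' r' m' → outcome H' r m ≡ outcome H'' r' m'
  foldEval-det (fStep e md d) (fStep e' md' d') with trans (sym e) e'
  ... | refl with mapEval-det md md'
  ... | refl with eval-det d d'
  ... | refl = refl

  mapEval-det : ∀ {Γ θ P c body Q H p H' r m H'' r' m'} → MapEval {Γ} θ P {c} body Q H p H' r m → MapEval θ P body Q H p H'' r' m' → outcome H' r m ≡ outcome H'' r' m'
  mapEval-det (mId f) (mId f') with foldEval-det f f'
  ... | refl = refl
  mapEval-det mK mK = refl
  mapEval-det (mInl e d) (mInl e' d') with trans (sym e) e'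
  ... | refl with mapEval-det d d'
  ... | refl = refl
  mapEval-det (mInl e d) (mInr e' d') with trans (sym e) e'
  ... | ()
  mapEval-det (mInr e d) (mInl e' d') with trans (sym e) e'
  ... | ()
  mapEval-det (mInr e d) (mInr e' d') with trans (sym e) e'
  ... | refl with mapEval-det d d'
  ... | refl = refl
  mapEval-det (mPair e d1 d2) (mPair e' d1' d2') with trans (sym e) e'
  ... | refl with mapEval-det d1 d1'
  ... | refl with mapEval-det d2 d2'
  ... | refl = refl

firstChild secondChild : Node → ℕ
firstChild nUnit = 0
firstChild (nInl _ c) = c
firstChild (nInr _ c) = c
firstChild (nPair _ c _) = c
firstChild (nCon _ c) = c
secondChild (nPair _ _ d) = d
secondChild _ = 0

μ-cong : ∀ {P P'} {w : T (base P)} {w' : T (base P')} → P ≡ P' → μ P w ≡ μ P' w'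
μ-cong {P} refl = cong (μ P) (T-irrelevant _ _)

drop₃ : ∀ {x y z x' y' z' : Bool} {xs ys} → _≡_ {A = List Bool} (x ∷ y ∷ z ∷ xs) (x' ∷ y' ∷ z' ∷ ys) → xs ≡ ys
drop₃ refl = refl

reassoc : ∀ (u v u' v' xs ys : List Bool) → (u ++ v) ++ xs ≡ (u' ++ v') ++ ys → u ++ v ++ xs ≡ u' ++ v' ++ ys
reassoc u v u' v' xs ys e = trans (sym (++-assoc u v xs)) (trans e (++-assoc u' v' ys))

mutual
  enc-++-injective : ∀ a b (xs ys : List Bool) → enc a ++ xs ≡ enc b ++ ys → a ≡ b × xs ≡ ys
  enc-++-injective unit unit xs ys e = refl , drop₃ e
  enc-++-injective (a ⊕ a') (b ⊕ b') xs ys e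
    with enc-++-injective a b _ _ (reassoc (enc a) (enc a') (enc b) (enc b') xs ys (drop₃ e))
  ... | refl , e' with enc-++-injective a' b' xs ys e'
  ... | refl , e'' = refl , e''
  enc-++-injective (a ⊗ a') (b ⊗ b') xs ys e
    with enc-++-injective a b _ _ (reassoc (enc a) (enc a') (enc b) (enc b') xs ys (drop₃ e))
  ... | refl , e' with enc-++-injective a' b' xs ys e'
  ... | refl , e'' = refl , e''
  enc-++-injective (μ P w) (μ Q w') xs ys e with encP-++-injective P Q xs ys (drop₃ e)
  ... | refl , e' = μ-cong refl , e'
  enc-++-injective unit (_ ⊕ _) xs ys ()
  enc-++-injective unit (_ ⊗ _) xs ys ()
  enc-++-injective unit (μ _ _) xs ys ()
  enc-++-injective (_ ⊕ _) unit xs ys ()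
  enc-++-injective (_ ⊕ _) (_ ⊗ _) xs ys ()
  enc-++-injective (_ ⊕ _) (μ _ _) xs ys ()
  enc-++-injective (_ ⊗ _) unit xs ys ()
  enc-++-injective (_ ⊗ _) (_ ⊕ _) xs ys ()
  enc-++-injective (_ ⊗ _) (μ _ _) xs ys ()
  enc-++-injective (μ _ _) unit xs ys ()
  enc-++-injective (μ _ _) (_ ⊕ _) xs ys ()
  enc-++-injective (μ _ _) (_ ⊗ _) xs ys ()

  encP-++-injective : ∀ P Q (xs ys : List Bool) → encP P ++ xs ≡ encP Q ++ ys → P ≡ Q × xs ≡ ys
  encP-++-injective Id Id xs ys e = refl , drop₃ e
  encP-++-injective (K a) (K b) xs ys e with enc-++-injective a b xs ys (drop₃ e)
  ... | refl , e' = refl , e'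
  encP-++-injective (P ⊕P P') (Q ⊕P Q') xs ys e
    with encP-++-injective P Q _ _ (reassoc (encP P) (encP P') (encP Q) (encP Q') xs ys (drop₃ e))
  ... | refl , e' with encP-++-injective P' Q' xs ys e'
  ... | refl , e'' = refl , e''
  encP-++-injective (P ⊗P P') (Q ⊗P Q') xs ys e
    with encP-++-injective P Q _ _ (reassoc (encP P) (encP P') (encP Q) (encP Q') xs ys (drop₃ e))
  ... | refl , e' with encP-++-injective P' Q' xs ys e'
  ... | refl , e'' = refl , e''
  encP-++-injective Id (K _) xs ys ()
  encP-++-injective Id (_ ⊕P _) xs ys ()
  encP-++-injective Id (_ ⊗P _) xs ys ()
  encP-++-injective (K _) Id xs ys ()
  encP-++-injective (K _) (_ ⊕P _) xs ys ()
  encP-++-injective (K _) (_ ⊗P _) xs ys ()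
  encP-++-injective (_ ⊕P _) Id xs ys ()
  encP-++-injective (_ ⊕P _) (K _) xs ys ()
  encP-++-injective (_ ⊕P _) (_ ⊗P _) xs ys ()
  encP-++-injective (_ ⊗P _) Id xs ys ()
  encP-++-injective (_ ⊗P _) (K _) xs ys ()
  encP-++-injective (_ ⊗P _) (_ ⊕P _) xs ys ()

enc-injective : ∀ a b → enc a ≡ enc b → a ≡ b
enc-injective a b e =
  proj₁ (enc-++-injective a b [] [] (trans (++-identityʳ (enc a)) (trans e (sym (++-identityʳ (enc b))))))

_≟Ty_ : DecidableEquality Ty
a ≟Ty b = map′ (enc-injective a b) (cong enc) (≡-dec Bool._≟_ (enc a) (enc b))

find∈ : (τ : Ty) (xs : List Ty) → Maybe (τ ∈ xs)
find∈ τ []       = nothing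
find∈ τ (x ∷ xs) with τ ≟Ty x
... | yes e = just (here e)
... | no _  = Maybe.map there (find∈ τ xs)

find∈-complete : ∀ {τ} xs → τ ∈ xs → Σ (τ ∈ xs) λ i → find∈ τ xs ≡ just i
find∈-complete {τ} (x ∷ xs) m with τ ≟Ty x
... | yes e = here e , refl
... | no ne with m
... | here e = ⊥-elim (ne e)
... | there m' with find∈-complete xs m'
... | i , eq = there i , cong (Maybe.map there) eq

-- For a μ type m, the types in vertexTypesP P m are those of P[m] other than m itself.
mutual
  vertexTypes : Ty → List Ty
  vertexTypes unit = unit ∷ []
  vertexTypes (a ⊕ b) = (a ⊕ b) ∷ vertexTypes a ++ vertexTypes b
  vertexTypes (a ⊗ b) = (a ⊗ b) ∷ vertexTypes a ++ vertexTypes b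
  vertexTypes (μ P w) = μ P w ∷ vertexTypesP P (μ P w)

  vertexTypesP : Poly → Ty → List Ty
  vertexTypesP Id m = []
  vertexTypesP (K a) m = vertexTypes a
  vertexTypesP (P ⊕P Q) m = (P ⟦ m ⟧ ⊕ Q ⟦ m ⟧) ∷ vertexTypesP P m ++ vertexTypesP Q m
  vertexTypesP (P ⊗P Q) m = (P ⟦ m ⟧ ⊗ Q ⟦ m ⟧) ∷ vertexTypesP P m ++ vertexTypesP Q m

childTypes : Ty → List Ty
childTypes unit = []
childTypes (a ⊕ b) = a ∷ b ∷ []
childTypes (a ⊗ b) = a ∷ b ∷ []
childTypes (μ P w) = P ⟦ μ P w ⟧ ∷ []

vertexTypes-self : ∀ γ → γ ∈ vertexTypes γ
vertexTypes-self unit = here refl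
vertexTypes-self (γ ⊕ γ₁) = here refl
vertexTypes-self (γ ⊗ γ₁) = here refl
vertexTypes-self (μ P x) = here refl

vertexTypesP-self : ∀ P m → P ⟦ m ⟧ ∈ m ∷ vertexTypesP P m
vertexTypesP-self Id m = here refl
vertexTypesP-self (K x) m = there (vertexTypes-self x)
vertexTypesP-self (P ⊕P P₁) m = there (here refl)
vertexTypesP-self (P ⊗P P₁) m = there (here refl)

∈-∷∷-++⁺ˡ : ∀ {x : Ty} {m h} (A B : List Ty) → x ∈ m ∷ A → x ∈ m ∷ h ∷ A ++ B
∈-∷∷-++⁺ˡ A B (here p) = here p
∈-∷∷-++⁺ˡ A B (there i) = there (there (∈-++⁺ˡ i))

∈-∷∷-++⁺ʳ : ∀ {x : Ty} {m h} (A B : List Ty) → x ∈ m ∷ B → x ∈ m ∷ h ∷ A ++ B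
∈-∷∷-++⁺ʳ A B (here p) = here p
∈-∷∷-++⁺ʳ A B (there i) = there (there (∈-++⁺ʳ A i))

mutual
  vertexTypes-closed : ∀ γ {τ x} → τ ∈ vertexTypes γ → x ∈ childTypes τ → x ∈ vertexTypes γ
  vertexTypes-closed unit (here refl) ()
  vertexTypes-closed unit (there ()) k
  vertexTypes-closed (a ⊕ b) (here refl) (here refl) = there (∈-++⁺ˡ (vertexTypes-self a))
  vertexTypes-closed (a ⊕ b) (here refl) (there (here refl)) = there (∈-++⁺ʳ (vertexTypes a) (vertexTypes-self b))
  vertexTypes-closed (a ⊕ b) (there i) k with ∈-++⁻ (vertexTypes a) i
  ... | inj₁ j = there (∈-++⁺ˡ (vertexTypes-closed a j k))
  ... | inj₂ j = there (∈-++⁺ʳ (vertexTypes a) (vertexTypes-closed b j k))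
  vertexTypes-closed (a ⊗ b) (here refl) (here refl) = there (∈-++⁺ˡ (vertexTypes-self a))
  vertexTypes-closed (a ⊗ b) (here refl) (there (here refl)) = there (∈-++⁺ʳ (vertexTypes a) (vertexTypes-self b))
  vertexTypes-closed (a ⊗ b) (there i) k with ∈-++⁻ (vertexTypes a) i
  ... | inj₁ j = there (∈-++⁺ˡ (vertexTypes-closed a j k))
  ... | inj₂ j = there (∈-++⁺ʳ (vertexTypes a) (vertexTypes-closed b j k))
  vertexTypes-closed (μ P w) (here refl) (here refl) = vertexTypesP-self P (μ P w)
  vertexTypes-closed (μ P w) (there i) k = vertexTypesP-closed P (μ P w) i k

  vertexTypesP-closed : ∀ P m {τ x} → τ ∈ vertexTypesP P m → x ∈ childTypes τ → x ∈ m ∷ vertexTypesP P m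
  vertexTypesP-closed Id m () k
  vertexTypesP-closed (K a) m i k = there (vertexTypes-closed a i k)
  vertexTypesP-closed (P ⊕P Q) m (here refl) (here refl) = ∈-∷∷-++⁺ˡ (vertexTypesP P m) (vertexTypesP Q m) (vertexTypesP-self P m)
  vertexTypesP-closed (P ⊕P Q) m (here refl) (there (here refl)) = ∈-∷∷-++⁺ʳ (vertexTypesP P m) (vertexTypesP Q m) (vertexTypesP-self Q m)
  vertexTypesP-closed (P ⊕P Q) m (there i) k with ∈-++⁻ (vertexTypesP P m) i
  ... | inj₁ j = ∈-∷∷-++⁺ˡ (vertexTypesP P m) (vertexTypesP Q m) (vertexTypesP-closed P m j k)
  ... | inj₂ j = ∈-∷∷-++⁺ʳ (vertexTypesP P m) (vertexTypesP Q m) (vertexTypesP-closed Q m j k)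
  vertexTypesP-closed (P ⊗P Q) m (here refl) (here refl) = ∈-∷∷-++⁺ˡ (vertexTypesP P m) (vertexTypesP Q m) (vertexTypesP-self P m)
  vertexTypesP-closed (P ⊗P Q) m (here refl) (there (here refl)) = ∈-∷∷-++⁺ʳ (vertexTypesP P m) (vertexTypesP Q m) (vertexTypesP-self Q m)
  vertexTypesP-closed (P ⊗P Q) m (there i) k with ∈-++⁻ (vertexTypesP P m) i
  ... | inj₁ j = ∈-∷∷-++⁺ˡ (vertexTypesP P m) (vertexTypesP Q m) (vertexTypesP-closed P m j k)
  ... | inj₂ j = ∈-∷∷-++⁺ʳ (vertexTypesP P m) (vertexTypesP Q m) (vertexTypesP-closed Q m j k)

-- The deserializer

natP strP vertP vtgP : Poly
natP = K unit ⊕P Id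
strP = K unit ⊕P (K boolT ⊗P Id)
vertP = K unit ⊕P K (stringT ⊗ natT) ⊕P K (stringT ⊗ natT) ⊕P K (stringT ⊗ (natT ⊗ natT)) ⊕P K (stringT ⊗ natT)
vtgP = K unit ⊕P (K vertexT ⊗P Id)

v0 : ∀ {Γ a} → Tm (a ∷ Γ) a
v0 = var (here refl)
v1 : ∀ {Γ a b} → Tm (b ∷ a ∷ Γ) a
v1 = var (there (here refl))
v2 : ∀ {Γ a b c} → Tm (c ∷ b ∷ a ∷ Γ) a
v2 = var (there (there (here refl)))
v3 : ∀ {Γ a b c d} → Tm (d ∷ c ∷ b ∷ a ∷ Γ) a
v3 = var (there (there (there (here refl))))

letIn : ∀ {Γ a c} → Tm Γ a → Tm (a ∷ Γ) c → Tm Γ c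
letIn e b = app (lam b) e

falseTm trueTm : ∀ {Γ} → Tm Γ boolT
falseTm = inl ⟨⟩
trueTm = inr ⟨⟩

zeroTm : ∀ {Γ} → Tm Γ natT
zeroTm = con natP tt (inl ⟨⟩)

equalsString : ∀ {Δ} → stringT ∈ Δ → List Bool → Tm Δ boolT
equalsString x [] = case (des strP tt (var x)) trueTm falseTm
equalsString x (false ∷ bs) = case (des strP tt (var x)) falseTm (case (fst v0) (letIn (snd v1) (equalsString (here refl) bs)) falseTm)
equalsString x (true ∷ bs) = case (des strP tt (var x)) falseTm (case (fst v0) falseTm (letIn (snd v1) (equalsString (here refl) bs)))

-- Junk values, for branches that are never taken on a representation of a γ-value.
mutual
  default : ∀ {Δ} (τ : Ty) → Tm Δ τ
  default unit = ⟨⟩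
  default (a ⊕ b) = inl (default a)
  default (a ⊗ b) = pair (default a) (default b)
  default (μ P w) = con P w (defaultP P w)

  defaultP : ∀ {Δ m} (P : Poly) → T (base P) → Tm Δ (P ⟦ m ⟧)
  defaultP Id ()
  defaultP (K a) w = default a
  defaultP (P ⊕P Q) w = defaultP⊕ P Q (Equivalence.to T-∨ w)
  defaultP (P ⊗P Q) w = pair (defaultP P (proj₁ (Equivalence.to T-∧ w))) (defaultP Q (proj₂ (Equivalence.to T-∧ w)))

  defaultP⊕ : ∀ {Δ m} (P Q : Poly) → T (base P) ⊎ T (base Q) → Tm Δ (P ⟦ m ⟧ ⊕ Q ⟦ m ⟧)
  defaultP⊕ P Q (inj₁ w1) = inl (defaultP P w1)
  defaultP⊕ P Q (inj₂ w2) = inr (defaultP Q w2)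

SumOf : List Ty → Ty
SumOf [] = unit
SumOf (x ∷ xs) = x ⊕ SumOf xs

junkSum : ∀ {Δ} xs → Tm Δ (SumOf xs)
junkSum [] = ⟨⟩
junkSum (x ∷ xs) = inr (junkSum xs)

injSum : ∀ {Δ τ xs} → τ ∈ xs → Tm Δ τ → Tm Δ (SumOf xs)
injSum (here refl) t = inl t
injSum (there i) t = inr (injSum i t)

projSum : ∀ {Δ τ} xs → τ ∈ xs → SumOf xs ∈ Δ → Tm Δ τ
projSum (x ∷ xs) (here refl) u = case (var u) v0 (default x)
projSum {τ = τ} (x ∷ xs) (there i) u = case (var u) (default τ) (projSum xs i (here refl))

module Deserializer (S : List Ty) where
  Univ Lookup Counter Scan Table : Ty
  Univ = SumOf S
  Lookup = Univ ⊕ unit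
  Counter = natT ⊕ unit
  Scan = Counter ⊗ Lookup
  TableP : Poly
  TableP = K unit ⊕P (K Univ ⊗P Id)
  Table = μ TableP tt

  extract : ∀ {Δ τ} → τ ∈ S → Lookup ∈ Δ → Tm Δ τ
  extract {τ = τ} i l = case (var l) (projSum S i (here refl)) (default τ)

  Maker : Set
  Maker = ∀ {Δ} → Lookup ∈ Δ → Lookup ∈ Δ → Tm Δ Univ

  dispatch : (Ty → Maybe Maker) → List Ty → ∀ {Δ} → stringT ∈ Δ → Lookup ∈ Δ → Lookup ∈ Δ → Tm Δ Univ
  dispatch info [] s l1 l2 = junkSum S
  dispatch info (τ ∷ τs) s l1 l2 with info τ
  ... | nothing = dispatch info τs s l1 l2
  ... | just mk = case (equalsString s (enc τ)) (dispatch info τs (there s) (there l1) (there l2)) (mk (there l1) (there l2))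

  inlMaker inrMaker pairMaker conMaker : Ty → Maybe Maker
  inlMaker (a ⊕ b) with find∈ (a ⊕ b) S | find∈ a S
  ... | just i | just ia = just (λ l1 l2 → injSum i (inl (extract ia l1)))
  ... | _ | _ = nothing
  inlMaker _ = nothing
  inrMaker (a ⊕ b) with find∈ (a ⊕ b) S | find∈ b S
  ... | just i | just ib = just (λ l1 l2 → injSum i (inr (extract ib l1)))
  ... | _ | _ = nothing
  inrMaker _ = nothing
  pairMaker (a ⊗ b) with find∈ (a ⊗ b) S | find∈ a S | find∈ b S
  ... | just i | just ia | just ib = just (λ l1 l2 → injSum i (pair (extract ia l1) (extract ib l2)))
  ... | _ | _ | _ = nothing
  pairMaker _ = nothing
  conMaker (μ P w) with find∈ (μ P w) S | find∈ (P ⟦ μ P w ⟧) S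
  ... | just i | just ic = just (λ l1 l2 → injSum i (con P w (extract ic l1)))
  ... | _ | _ = nothing
  conMaker _ = nothing

  buildUnitVertex : ∀ {Δ} → Tm Δ Univ
  buildUnitVertex with find∈ unit S
  ... | just i = injSum i ⟨⟩
  ... | nothing = junkSum S

  buildVertex : ∀ {Δ} → vertexT ∈ Δ → Lookup ∈ Δ → Lookup ∈ Δ → Tm Δ Univ
  buildVertex vx l1 l2 =
    case (des vertP tt (var vx))
      buildUnitVertex
      (case v0
        (letIn (fst v0) (dispatch inlMaker S (here refl) (there (there (there l1))) (there (there (there l2)))))
        (case v0
          (letIn (fst v0) (dispatch inrMaker S (here refl) (there (there (there (there l1)))) (there (there (there (there l2))))))
          (case v0
            (letIn (fst v0) (dispatch pairMaker S (here refl) (there (there (there (there (there l1))))) (there (there (there (there (there l2)))))))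
            (letIn (fst v0) (dispatch conMaker S (here refl) (there (there (there (there (there l1))))) (there (there (there (there (there l2))))))))))

  firstAddress secondAddress : ∀ {Δ} → vertexT ∈ Δ → Tm Δ natT
  firstAddress vx = case (des vertP tt (var vx)) zeroTm (case v0 (snd v0) (case v0 (snd v0) (case v0 (fst (snd v0)) (snd v0))))
  secondAddress vx = case (des vertP tt (var vx)) zeroTm (case v0 zeroTm (case v0 zeroTm (case v0 (snd (snd v0)) zeroTm)))

  -- One step of the lookup fold over the table, oldest entry first: the address is counted
  -- down, and the entry at which the counter reaches zero is returned.
  scanStep : ∀ {Γ} → Tm (TableP ⟦ Scan ⟧ ∷ natT ∷ Γ) Scan
  scanStep = case v0
    (pair (inl v2) (inr ⟨⟩))
    (case (fst (snd v0))
       (case (des natP tt v0)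
          (pair (inr ⟨⟩) (inl (fst v2)))
          (pair (inl v0) (snd (snd v2))))
       (pair (inr ⟨⟩) (snd (snd v1))))

  lookupTable : ∀ {Γ} → Table ∈ Γ → Tm Γ natT → Tm Γ Lookup
  lookupTable acc addr = letIn addr (snd (fold TableP tt (lam scanStep) (var (there acc))))

  tableCons : ∀ {Γ} → Tm ((vertexT ⊗ Table) ∷ vtgP ⟦ Table ⟧ ∷ Γ) Table
  tableCons = letIn (snd v0)
      (letIn (fst v1)
        (letIn (lookupTable (there (here refl)) (firstAddress (here refl)))
          (letIn (lookupTable (there (there (here refl))) (secondAddress (there (here refl))))
            (con TableP tt (inr (pair (buildVertex (there (there (here refl))) (there (here refl)) (here refl)) v3))))))

  tableNil : ∀ {Γ} → Tm (unit ∷ vtgP ⟦ Table ⟧ ∷ Γ) Table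
  tableNil = con TableP tt (inl ⟨⟩)

  tableStep : ∀ {Γ} → Tm (vtgP ⟦ Table ⟧ ∷ Γ) Table
  tableStep = case v0 tableNil tableCons

  readRoot : ∀ {Γ} (γ : Ty) → Maybe (γ ∈ S) → Tm (Table ∷ Γ) γ
  readRoot γ nothing = default γ
  readRoot γ (just i) = case (des TableP tt v0) (default γ) (letIn (fst v0) (projSum S i (here refl)))

  deserializeBody : (γ : Ty) → Tm (vtg ∷ []) γ
  deserializeBody γ = letIn (fold vtgP tt (lam tableStep) v0) (readRoot γ (find∈ γ S))

  deserialize : (γ : Ty) → Fun [] vtg γ
  deserialize γ = lam (deserializeBody γ)

RenEnv : ∀ {Γ Δ} → Ren Γ Δ → Env Γ → Env Δ → Set
RenEnv {Γ} ρ θ θ' = ∀ {a} (x : a ∈ Γ) → All.lookup θ' (ρ x) ≡ All.lookup θ x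

RenEnv-ext : ∀ {Γ Δ b} {ρ : Ren Γ Δ} {θ θ'} (q : ℕ) → RenEnv ρ θ θ' → RenEnv (ext {b = b} ρ) (q ∷ θ) (q ∷ θ')
RenEnv-ext q ok (here refl) = refl
RenEnv-ext q ok (there x) = ok x

mutual
  eval-ren : ∀ {Γ Δ a} {ρ : Ren Γ Δ} {θ θ'} → RenEnv ρ θ θ' → ∀ {H H' r n} {t : Tm Γ a} →
        Eval H θ t H' r n → Eval H θ' (ren ρ t) H' r n
  eval-ren {ρ = ρ} {θ' = θ'} ok {H} (eVar {x = x}) = subst (λ z → Eval H θ' (var (ρ x)) H z 1) (ok x) eVar
  eval-ren ok eUnit = eUnit
  eval-ren ok (ePair d d₁) = ePair (eval-ren ok d) (eval-ren ok d₁)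
  eval-ren ok (eFst d x) = eFst (eval-ren ok d) x
  eval-ren ok (eSnd d x) = eSnd (eval-ren ok d) x
  eval-ren ok (eInl d) = eInl (eval-ren ok d)
  eval-ren ok (eInr d) = eInr (eval-ren ok d)
  eval-ren ok (eCaseL {q = q} d x d₁) = eCaseL (eval-ren ok d) x (eval-ren (RenEnv-ext q ok) d₁)
  eval-ren ok (eCaseR {q = q} d x d₁) = eCaseR (eval-ren ok d) x (eval-ren (RenEnv-ext q ok) d₁)
  eval-ren ok (eCon d) = eCon (eval-ren ok d)
  eval-ren ok (eDes d x) = eDes (eval-ren ok d) x
  eval-ren ok (eApp {p = p} d d₁) = eApp (eval-ren ok d) (eval-ren (RenEnv-ext p ok) d₁)
  eval-ren ok (eFold d x) = eFold (eval-ren ok d) (foldEval-ren ok x)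

  foldEval-ren : ∀ {Γ Δ} {ρ : Ren Γ Δ} {θ θ'} → RenEnv ρ θ θ' → ∀ {P c} {body : Tm (P ⟦ c ⟧ ∷ Γ) c} {H p H' r m} →
         FoldEval θ P body H p H' r m → FoldEval θ' P (ren (ext ρ) body) H p H' r m
  foldEval-ren ok (fStep {q' = q'} x x₁ x₂) = fStep x (mapEval-ren ok x₁) (eval-ren (RenEnv-ext q' ok) x₂)

  mapEval-ren : ∀ {Γ Δ} {ρ : Ren Γ Δ} {θ θ'} → RenEnv ρ θ θ' → ∀ {P c Q} {body : Tm (P ⟦ c ⟧ ∷ Γ) c} {H p H' r m} →
         MapEval θ P body Q H p H' r m → MapEval θ' P (ren (ext ρ) body) Q H p H' r m
  mapEval-ren ok (mId x) = mId (foldEval-ren ok x)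
  mapEval-ren ok mK = mK
  mapEval-ren ok (mInl x d) = mInl x (mapEval-ren ok d)
  mapEval-ren ok (mInr x d) = mInr x (mapEval-ren ok d)
  mapEval-ren ok (mPair x d d₁) = mPair x (mapEval-ren ok d) (mapEval-ren ok d₁)

mutual
  eval-unren : ∀ {Γ Δ a} {ρ : Ren Γ Δ} {θ θ'} → RenEnv ρ θ θ' → ∀ {H H' r n} (t : Tm Γ a) →
        Eval H θ' (ren ρ t) H' r n → Eval H θ t H' r n
  eval-unren {ρ = ρ} {θ = θ} ok {H} (var x) eVar = subst (λ z → Eval H θ (var x) H z 1) (sym (ok x)) eVar
  eval-unren ok ⟨⟩ eUnit = eUnit
  eval-unren ok (pair t t₁) (ePair d d₁) = ePair (eval-unren ok t d) (eval-unren ok t₁ d₁)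
  eval-unren ok (fst t) (eFst d x) = eFst (eval-unren ok t d) x
  eval-unren ok (snd t) (eSnd d x) = eSnd (eval-unren ok t d) x
  eval-unren ok (inl t) (eInl d) = eInl (eval-unren ok t d)
  eval-unren ok (inr t) (eInr d) = eInr (eval-unren ok t d)
  eval-unren ok (case t t₁ t₂) (eCaseL {q = q} d x d₁) = eCaseL (eval-unren ok t d) x (eval-unren (RenEnv-ext q ok) t₁ d₁)
  eval-unren ok (case t t₁ t₂) (eCaseR {q = q} d x d₁) = eCaseR (eval-unren ok t d) x (eval-unren (RenEnv-ext q ok) t₂ d₁)
  eval-unren ok (con P w t) (eCon d) = eCon (eval-unren ok t d)
  eval-unren ok (des P w t) (eDes d x) = eDes (eval-unren ok t d) x
  eval-unren ok (app (lam b) t) (eApp {p = p} d d₁) = eApp (eval-unren ok t d) (eval-unren (RenEnv-ext p ok) b d₁)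
  eval-unren ok (fold P w (lam b) t) (eFold d x) = eFold (eval-unren ok t d) (foldEval-unren ok b x)

  foldEval-unren : ∀ {Γ Δ} {ρ : Ren Γ Δ} {θ θ'} → RenEnv ρ θ θ' → ∀ {P c} (body : Tm (P ⟦ c ⟧ ∷ Γ) c) {H p H' r m} →
         FoldEval θ' P (ren (ext ρ) body) H p H' r m → FoldEval θ P body H p H' r m
  foldEval-unren ok body (fStep {q' = q'} x x₁ x₂) = fStep x (mapEval-unren ok body x₁) (eval-unren (RenEnv-ext q' ok) body x₂)

  mapEval-unren : ∀ {Γ Δ} {ρ : Ren Γ Δ} {θ θ'} → RenEnv ρ θ θ' → ∀ {P c Q} (body : Tm (P ⟦ c ⟧ ∷ Γ) c) {H p H' r m} →
         MapEval θ' P (ren (ext ρ) body) Q H p H' r m → MapEval θ P body Q H p H' r m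
  mapEval-unren ok body (mId x) = mId (foldEval-unren ok body x)
  mapEval-unren ok body mK = mK
  mapEval-unren ok body (mInl x d) = mInl x (mapEval-unren ok body d)
  mapEval-unren ok body (mInr x d) = mInr x (mapEval-unren ok body d)
  mapEval-unren ok body (mPair x d d₁) = mPair x (mapEval-unren ok body d) (mapEval-unren ok body d₁)

-- Cost

tmSize : ∀ {Γ a} → Tm Γ a → ℕ
tmSize (var x) = 1
tmSize ⟨⟩ = 1
tmSize (pair t t₁) = suc (tmSize t + tmSize t₁)
tmSize (fst t) = suc (tmSize t)
tmSize (snd t) = suc (tmSize t)
tmSize (inl t) = suc (tmSize t)
tmSize (inr t) = suc (tmSize t)
tmSize (case t t₁ t₂) = suc (tmSize t + (tmSize t₁ + tmSize t₂))
tmSize (con P w t) = suc (tmSize t)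
tmSize (des P w t) = suc (tmSize t)
tmSize (app (lam b) t) = suc (tmSize t + tmSize b)
tmSize (fold P w f t) = 0

FoldFree : ∀ {Γ a} → Tm Γ a → Set
FoldFree (var x) = ⊤
FoldFree ⟨⟩ = ⊤
FoldFree (pair t t₁) = FoldFree t × FoldFree t₁
FoldFree (fst t) = FoldFree t
FoldFree (snd t) = FoldFree t
FoldFree (inl t) = FoldFree t
FoldFree (inr t) = FoldFree t
FoldFree (case t t₁ t₂) = FoldFree t × (FoldFree t₁ × FoldFree t₂)
FoldFree (con P w t) = FoldFree t
FoldFree (des P w t) = FoldFree t
FoldFree (app (lam b) t) = FoldFree t × FoldFree b
FoldFree (fold P w f t) = ⊥

foldFree-cost : ∀ {Γ a H θ} (t : Tm Γ a) {H' r n} → FoldFree t → Eval H θ t H' r n → n ≤ tmSize t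
foldFree-cost (var x) f eVar = ≤-refl
foldFree-cost ⟨⟩ f eUnit = ≤-refl
foldFree-cost (pair t t₁) (f , f₁) (ePair d d₁) = s≤s (+-mono-≤ (foldFree-cost t f d) (foldFree-cost t₁ f₁ d₁))
foldFree-cost (fst t) f (eFst d x) = s≤s (foldFree-cost t f d)
foldFree-cost (snd t) f (eSnd d x) = s≤s (foldFree-cost t f d)
foldFree-cost (inl t) f (eInl d) = s≤s (foldFree-cost t f d)
foldFree-cost (inr t) f (eInr d) = s≤s (foldFree-cost t f d)
foldFree-cost (case t t₁ t₂) (f , f₁ , f₂) (eCaseL d x d₁) = s≤s (+-mono-≤ (foldFree-cost t f d) (≤-trans (foldFree-cost t₁ f₁ d₁) (m≤m+n _ _)))
foldFree-cost (case t t₁ t₂) (f , f₁ , f₂) (eCaseR d x d₁) = s≤s (+-mono-≤ (foldFree-cost t f d) (≤-trans (foldFree-cost t₂ f₂ d₁) (m≤n+m _ _)))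
foldFree-cost (con P w t) f (eCon d) = s≤s (foldFree-cost t f d)
foldFree-cost (des P w t) f (eDes d x) = s≤s (foldFree-cost t f d)
foldFree-cost (app (lam b) t) (f , f₁) (eApp d d₁) = s≤s (+-mono-≤ (foldFree-cost t f d) (foldFree-cost b f₁ d₁))

foldFree-equalsString : ∀ {Δ} (x : stringT ∈ Δ) bs → FoldFree (equalsString x bs)
foldFree-equalsString x [] = tt , tt , tt
foldFree-equalsString x (false ∷ bs) = tt , tt , (tt , (tt , foldFree-equalsString (here refl) bs) , tt)
foldFree-equalsString x (true ∷ bs) = tt , tt , (tt , tt , (tt , foldFree-equalsString (here refl) bs))

mutual
  foldFree-default : ∀ {Δ} τ → FoldFree (default {Δ} τ)
  foldFree-default unit = tt
  foldFree-default (a ⊕ b) = foldFree-default a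
  foldFree-default (a ⊗ b) = foldFree-default a , foldFree-default b
  foldFree-default (μ P w) = foldFree-defaultP P w

  foldFree-defaultP : ∀ {Δ m} P w → FoldFree (defaultP {Δ} {m} P w)
  foldFree-defaultP Id ()
  foldFree-defaultP (K a) w = foldFree-default a
  foldFree-defaultP {Δ} {m} (P ⊕P Q) w = foldFree-defaultP⊕ {Δ} {m} P Q (Equivalence.to T-∨ w)
  foldFree-defaultP {Δ} {m} (P ⊗P Q) w = foldFree-defaultP {Δ} {m} P _ , foldFree-defaultP {Δ} {m} Q _

  foldFree-defaultP⊕ : ∀ {Δ m} P Q w → FoldFree (defaultP⊕ {Δ} {m} P Q w)
  foldFree-defaultP⊕ P Q (inj₁ w1) = foldFree-defaultP P w1
  foldFree-defaultP⊕ P Q (inj₂ w2) = foldFree-defaultP Q w2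

foldFree-junkSum : ∀ {Δ} xs → FoldFree (junkSum {Δ} xs)
foldFree-junkSum [] = tt
foldFree-junkSum (x ∷ xs) = foldFree-junkSum xs

foldFree-injSum : ∀ {Δ τ xs} (i : τ ∈ xs) (t : Tm Δ τ) → FoldFree t → FoldFree (injSum {xs = xs} i t)
foldFree-injSum (here refl) t f = f
foldFree-injSum (there i) t f = foldFree-injSum i t f

foldFree-projSum : ∀ {Δ τ} xs (i : τ ∈ xs) (u : SumOf xs ∈ Δ) → FoldFree (projSum xs i u)
foldFree-projSum (x ∷ xs) (here refl) u = tt , tt , foldFree-default x
foldFree-projSum {τ = τ} (x ∷ xs) (there i) u = tt , foldFree-default τ , foldFree-projSum xs i (here refl)

module FoldFreeness (S : List Ty) where
  open Deserializer S

  foldFree-extract : ∀ {Δ τ} (i : τ ∈ S) (l : Lookup ∈ Δ) → FoldFree (extract i l)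
  foldFree-extract {τ = τ} i l = tt , foldFree-projSum S i (here refl) , foldFree-default τ

  FoldFreeMaker : (Ty → Maybe Maker) → Set
  FoldFreeMaker info = ∀ τ (mk : Maker) → info τ ≡ just mk → ∀ {Δ} (l1 l2 : Lookup ∈ Δ) → FoldFree (mk l1 l2)

  foldFree-dispatch : ∀ info → FoldFreeMaker info → ∀ τs {Δ} (s : stringT ∈ Δ) l1 l2 → FoldFree (dispatch info τs s l1 l2)
  foldFree-dispatch info h [] s l1 l2 = foldFree-junkSum S
  foldFree-dispatch info h (τ ∷ τs) s l1 l2 with info τ in eq
  ... | nothing = foldFree-dispatch info h τs s l1 l2
  ... | just mk = foldFree-equalsString s (enc τ) , foldFree-dispatch info h τs _ _ _ , h τ _ eq _ _

  foldFree-inlMaker : FoldFreeMaker inlMaker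
  foldFree-inlMaker (a ⊕ b) mk eq l1 l2 with find∈ (a ⊕ b) S | find∈ a S
  foldFree-inlMaker (a ⊕ b) mk refl l1 l2 | just i | just ia = foldFree-injSum i _ (foldFree-extract ia l1)
  foldFree-inlMaker (a ⊕ b) mk () l1 l2 | just i | nothing
  foldFree-inlMaker (a ⊕ b) mk () l1 l2 | nothing | _
  foldFree-inlMaker unit mk () l1 l2
  foldFree-inlMaker (a ⊗ b) mk () l1 l2
  foldFree-inlMaker (μ P w) mk () l1 l2

  foldFree-inrMaker : FoldFreeMaker inrMaker
  foldFree-inrMaker (a ⊕ b) mk eq l1 l2 with find∈ (a ⊕ b) S | find∈ b S
  foldFree-inrMaker (a ⊕ b) mk refl l1 l2 | just i | just ib = foldFree-injSum i _ (foldFree-extract ib l1)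
  foldFree-inrMaker (a ⊕ b) mk () l1 l2 | just i | nothing
  foldFree-inrMaker (a ⊕ b) mk () l1 l2 | nothing | _
  foldFree-inrMaker unit mk () l1 l2
  foldFree-inrMaker (a ⊗ b) mk () l1 l2
  foldFree-inrMaker (μ P w) mk () l1 l2

  foldFree-pairMaker : FoldFreeMaker pairMaker
  foldFree-pairMaker (a ⊗ b) mk eq l1 l2 with find∈ (a ⊗ b) S | find∈ a S | find∈ b S
  foldFree-pairMaker (a ⊗ b) mk refl l1 l2 | just i | just ia | just ib = foldFree-injSum i _ (foldFree-extract ia l1 , foldFree-extract ib l2)
  foldFree-pairMaker (a ⊗ b) mk () l1 l2 | just i | just ia | nothing
  foldFree-pairMaker (a ⊗ b) mk () l1 l2 | just i | nothing | _
  foldFree-pairMaker (a ⊗ b) mk () l1 l2 | nothing | _ | _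
  foldFree-pairMaker unit mk () l1 l2
  foldFree-pairMaker (a ⊕ b) mk () l1 l2
  foldFree-pairMaker (μ P w) mk () l1 l2

  foldFree-conMaker : FoldFreeMaker conMaker
  foldFree-conMaker (μ P w) mk eq l1 l2 with find∈ (μ P w) S | find∈ (P ⟦ μ P w ⟧) S
  foldFree-conMaker (μ P w) mk refl l1 l2 | just i | just ic = foldFree-injSum i _ (foldFree-extract ic l1)
  foldFree-conMaker (μ P w) mk () l1 l2 | just i | nothing
  foldFree-conMaker (μ P w) mk () l1 l2 | nothing | _
  foldFree-conMaker unit mk () l1 l2
  foldFree-conMaker (a ⊕ b) mk () l1 l2
  foldFree-conMaker (a ⊗ b) mk () l1 l2

  foldFree-buildUnitVertex : ∀ {Δ} → FoldFree (buildUnitVertex {Δ})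
  foldFree-buildUnitVertex with find∈ unit S
  ... | just i = foldFree-injSum i ⟨⟩ tt
  ... | nothing = foldFree-junkSum S

  foldFree-buildVertex : ∀ {Δ} (vx : vertexT ∈ Δ) l1 l2 → FoldFree (buildVertex vx l1 l2)
  foldFree-buildVertex vx l1 l2 = tt , foldFree-buildUnitVertex , tt , (tt , foldFree-dispatch inlMaker foldFree-inlMaker S _ _ _) ,
      tt , (tt , foldFree-dispatch inrMaker foldFree-inrMaker S _ _ _) ,
      tt , (tt , foldFree-dispatch pairMaker foldFree-pairMaker S _ _ _) , (tt , foldFree-dispatch conMaker foldFree-conMaker S _ _ _)

  foldFree-firstAddress : ∀ {Δ} (vx : vertexT ∈ Δ) → FoldFree (firstAddress vx)
  foldFree-firstAddress vx = tt , tt , tt , tt , tt , tt , tt , tt , tt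

  foldFree-secondAddress : ∀ {Δ} (vx : vertexT ∈ Δ) → FoldFree (secondAddress vx)
  foldFree-secondAddress vx = tt , tt , tt , tt , tt , tt , tt , tt , tt

  foldFree-scanStep : ∀ {Γ} → FoldFree (scanStep {Γ})
  foldFree-scanStep = tt , (tt , tt) , (tt , (tt , (tt , tt) , (tt , tt)) , (tt , tt))

  foldFree-readRoot : ∀ {Γ} γ m → FoldFree (readRoot {Γ} γ m)
  foldFree-readRoot γ nothing = foldFree-default γ
  foldFree-readRoot γ (just i) = tt , foldFree-default γ , (tt , foldFree-projSum S i (here refl))

data Spine (H : Heap) : ℕ → ℕ → Set where
  spNil : ∀ {p γ δ q u} → nth H p ≡ just (nCon γ q) → nth H q ≡ just (nInl δ u) → Spine H p 0
  spCons : ∀ {p γ δ ε q u x l t} → nth H p ≡ just (nCon γ q) → nth H q ≡ just (nInr δ u) →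
           nth H u ≡ just (nPair ε x l) → Spine H l t → Spine H p (suc t)

spine-⊑ : ∀ {H H' p t} → H ⊑ H' → Spine H p t → Spine H' p t
spine-⊑ x (spNil e1 e2) = spNil (nth-⊑ x e1) (nth-⊑ x e2)
spine-⊑ x (spCons e1 e2 e3 s) = spCons (nth-⊑ x e1) (nth-⊑ x e2) (nth-⊑ x e3) (spine-⊑ x s)

remove : ∀ {v : ℕ} xs → v ∈ xs → List ℕ
remove (x ∷ xs) (here _) = xs
remove (x ∷ xs) (there i) = x ∷ remove xs i

remove-length : ∀ {v : ℕ} xs (i : v ∈ xs) → suc (length (remove xs i)) ≡ length xs
remove-length (x ∷ xs) (here _) = refl
remove-length (x ∷ xs) (there i) = cong suc (remove-length xs i)

remove-∈ : ∀ {v w : ℕ} xs (i : v ∈ xs) → w ∈ xs → w ≢ v → w ∈ remove xs i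
remove-∈ (x ∷ xs) (here refl) (here refl) ne = ⊥-elim (ne refl)
remove-∈ (x ∷ xs) (here refl) (there j) ne = j
remove-∈ (x ∷ xs) (there i) (here refl) ne = here refl
remove-∈ (x ∷ xs) (there i) (there j) ne = there (remove-∈ xs i j ne)

unique-length-≤ : ∀ (vs xs : List ℕ) → Unique vs → (∀ v → v ∈ vs → v ∈ xs) → length vs ≤ length xs
unique-length-≤ [] xs u h = z≤n
unique-length-≤ (v ∷ vs) xs (a ∷ u) h =
  subst (suc (length vs) ≤_) (remove-length xs i)
    (s≤s (unique-length-≤ vs (remove xs i) u (λ w w∈ → remove-∈ xs i (h w (there w∈)) (λ e → All.lookup a w∈ (sym e)))))
  where i = h v (here refl)

Reach-trans : ∀ {H a b c} → Reach H a b → Reach H b c → Reach H a c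
Reach-trans r root = r
Reach-trans r (step r' e c) = step (Reach-trans r r') e c

module Cost (S : List Ty) where
  open Deserializer S
  open FoldFreeness S

  scanStepSize : ℕ
  scanStepSize = tmSize (scanStep {[]})

  -- Abstract: as a closed numeral it would be unfolded into unary form in every bound below.
  abstract
    scanCost : ℕ
    scanCost = 5 + scanStepSize
    scanCost-≡ : scanCost ≡ 5 + scanStepSize
    scanCost-≡ = refl

  scanCost-nil : ∀ {m2 B} → m2 ≤ B → suc (suc (suc m2)) ≤ 5 + B + 0
  scanCost-nil {m2} {B} h = subst (suc (suc (suc m2)) ≤_) (eq B) (≤-trans (s≤s (s≤s (s≤s h))) (≤-trans (n≤1+n _) (n≤1+n _)))
    where
    eq : ∀ B → suc (suc (suc (suc (suc B)))) ≡ 5 + B + 0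
    eq = solve-∀

  scanCost-cons : ∀ {m' m2 A B} → m' ≤ A → m2 ≤ B → suc (suc (suc (suc (suc (m' + m2))))) ≤ 5 + B + A
  scanCost-cons {m'} {m2} {A} {B} h1 h2 = subst (suc (suc (suc (suc (suc (m' + m2))))) ≤_) (eq A B) (s≤s (s≤s (s≤s (s≤s (s≤s (+-mono-≤ h1 h2))))))
    where
    eq : ∀ A B → suc (suc (suc (suc (suc (A + B))))) ≡ 5 + B + A
    eq = solve-∀

  scanFold-cost : ∀ {Γ} {θ : Env (natT ∷ Γ)} {H p H' r m t} → Spine H p t → FoldEval θ TableP scanStep H p H' r m → m ≤ scanCost * suc t
  scanFold-cost {Γ} (spNil e1 e2) (fStep e md db) with trans (sym e1) e
  ... | refl with md
  ... | mInl e' mK =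
    ≤-trans (scanCost-nil {B = scanStepSize} (foldFree-cost (scanStep {Γ}) (foldFree-scanStep {Γ}) db))
            (≤-reflexive (trans (cong (_+ 0) (sym scanCost-≡)) (trans (+-identityʳ scanCost) (sym (*-identityʳ scanCost)))))
  ... | mInr e' _ with trans (sym e2) e'
  ... | ()
  scanFold-cost {Γ} {t = suc t} (spCons e1 e2 e3 sh) (fStep e md db) with trans (sym e1) e
  ... | refl with md
  ... | mInl e' _ with trans (sym e2) e'
  ... | ()
  scanFold-cost {Γ} {t = suc t} (spCons e1 e2 e3 sh) (fStep e md db) | refl | mInr e' (mPair e'' mK (mId fd')) with trans (sym e2) e'
  ... | refl with trans (sym e3) e''
  ... | refl = ≤-trans (scanCost-cons {A = scanCost * suc t} {B = scanStepSize} (scanFold-cost sh fd') (foldFree-cost (scanStep {Γ}) (foldFree-scanStep {Γ}) db))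
                        (≤-reflexive (trans (cong (_+ scanCost * suc t) (sym scanCost-≡)) (sym (*-suc scanCost (suc t)))))

  lookupTable-cost : ∀ {Γ} (acc : Table ∈ Γ) (addr : Tm Γ natT) {H θ H' r n t} → FoldFree addr →
             Spine H (All.lookup θ acc) t → Eval H θ (lookupTable acc addr) H' r n →
             n ≤ suc (tmSize addr + suc (suc (suc (scanCost * suc t))))
  lookupTable-cost acc addr f sh (eApp da (eSnd (eFold eVar fd) _)) =
    s≤s (+-mono-≤ (foldFree-cost addr f da) (s≤s (s≤s (s≤s (scanFold-cost (spine-⊑ (eval-⊑ da) sh) fd)))))

  module TableCost {Γ : Ctx} (θ0 : Env (vtg ∷ Γ)) where
    TableStepArg : Ty
    TableStepArg = vtgP ⟦ Table ⟧
    BuildCtx : Ctx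
    BuildCtx = Lookup ∷ Lookup ∷ vertexT ∷ Table ∷ (vertexT ⊗ Table) ∷ TableStepArg ∷ vtg ∷ Γ

    buildSize address₁Size address₂Size stepConst tableConst : ℕ
    buildSize = tmSize (buildVertex {BuildCtx} (there (there (here refl))) (there (here refl)) (here refl))
    address₁Size = tmSize (firstAddress {vertexT ∷ Table ∷ (vertexT ⊗ Table) ∷ TableStepArg ∷ vtg ∷ Γ} (here refl))
    address₂Size = tmSize (secondAddress {Lookup ∷ vertexT ∷ Table ∷ (vertexT ⊗ Table) ∷ TableStepArg ∷ vtg ∷ Γ} (there (here refl)))
    stepConst = 27 + address₁Size + address₂Size + buildSize
    tableConst = 8 + stepConst + scanCost + scanCost

    tableBound : ℕ → ℕ
    tableBound t = tableConst * (suc t * suc t)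

    tableBound-0 : 8 ≤ tableBound 0
    tableBound-0 = ≤-trans (m≤m+n 8 (stepConst + scanCost + scanCost)) (≤-reflexive (trans (solve0 (stepConst + scanCost + scanCost)) refl))
      where
      solve0 : ∀ x → 8 + x ≡ (8 + x) * (1 * 1)
      solve0 = solve-∀

    tableBound-suc : ∀ t' {m' m} → m' ≤ tableBound t' → m ≤ m' + (stepConst + (scanCost * suc t' + scanCost * suc t')) → m ≤ tableBound (suc t')
    tableBound-suc t' {m'} {m} h1 h2 = ≤-trans h2 (≤-trans (+-mono-≤ h1 (+-mono-≤ cst≤E (+-mono-≤ x≤ x≤))) (≤-reflexive (sym (eqG tableConst t'))))
      where
      cst≤E : stepConst ≤ tableConst
      cst≤E = ≤-trans (m≤n+m stepConst 8) (≤-trans (m≤m+n (8 + stepConst) scanCost) (m≤m+n (8 + stepConst + scanCost) scanCost))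
      CL≤E : scanCost ≤ tableConst
      CL≤E = ≤-trans (m≤n+m scanCost (8 + stepConst)) (m≤m+n (8 + stepConst + scanCost) scanCost)
      x≤ : scanCost * suc t' ≤ tableConst * suc t'
      x≤ = *-monoˡ-≤ (suc t') CL≤E
      eqG : ∀ tableConst t' → tableConst * (suc (suc t') * suc (suc t')) ≡ tableConst * (suc t' * suc t') + (tableConst + (tableConst * suc t' + tableConst * suc t'))
      eqG = solve-∀

    record TableRun (H : Heap) (p : ℕ) (H2 : Heap) (r m : ℕ) : Set where
      field
        t : ℕ
        spine : Spine H2 r t
        bound : m ≤ tableBound t
        cells : List ℕ
        cells-length : length cells ≡ suc t
        cells-unique : Unique cells
        cells-reach : ∀ v → v ∈ cells → Reach H p v × IsCon H v
        cells-fold : ∀ v → v ∈ cells → Σ Heap λ H' → Σ ℕ λ r' → Σ ℕ λ m' → FoldEval θ0 vtgP tableStep H v H' r' m' × m' ≤ m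

    open TableRun

    tableRun-nil : ∀ {H p γ q H2 r m2 γ' u} → (e : nth H p ≡ just (nCon γ q)) → (e' : nth H q ≡ just (nInl γ' u)) →
             (db : Eval (alloc H (nInl TableStepArg u)) (length H ∷ θ0) tableStep H2 r m2) →
             TableRun H p H2 r (suc (2 + m2))
    tableRun-nil {H} {p} e e' db@(eCaseL eVar e3 (eCon (eInl (eUnit {H = H1})))) = record
      { t = 0
      ; spine = spNil (nth-alloc (alloc (alloc H1 nUnit) (nInl (unit ⊕ (Univ ⊗ Table)) (length H1))) _) (nth-alloc₁ (alloc H1 nUnit) _ _)
      ; bound = tableBound-0
      ; cells = p ∷ []
      ; cells-length = refl
      ; cells-unique = [] ∷ []
      ; cells-reach = λ { v (here refl) → root , (_ , _ , e) }
      ; cells-fold = λ { v (here refl) → _ , _ , _ , fStep e (mInl e' mK) db , ≤-refl }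
      }
    tableRun-nil {H} e e' (eCaseR eVar e3 _) with trans (sym (nth-alloc H _)) e3
    ... | ()

    consConst : ℕ
    consConst = 8 + address₁Size + address₂Size + buildSize

    cons-arith : ∀ nl1 nl2 nb → suc (2 + suc (2 + suc (nl1 + suc (nl2 + suc (suc (suc (nb + 1))))))) ≡ 12 + (nl1 + nl2 + nb)
    cons-arith = solve-∀

    cons-bound : ∀ {nl1 nl2 nb X} → nl1 ≤ suc (address₁Size + suc (suc (suc X))) → nl2 ≤ suc (address₂Size + suc (suc (suc X))) → nb ≤ buildSize →
          12 + (nl1 + nl2 + nb) ≤ 12 + consConst + (X + X)
    cons-bound {nl1} {nl2} {nb} {X} h1 h2 h3 = ≤-trans (+-mono-≤ (≤-refl {12}) (+-mono-≤ (+-mono-≤ h1 h2) h3)) (≤-reflexive (eq address₁Size address₂Size buildSize X))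
      where
      eq : ∀ a₁ a₂ b X → 12 + (suc (a₁ + suc (suc (suc X))) + suc (a₂ + suc (suc (suc X))) + b) ≡ 12 + (8 + a₁ + a₂ + b) + (X + X)
      eq = solve-∀

    tableCons-cost : ∀ {H1c qq q' x r' t' H2 r mc} → nth H1c qq ≡ just (nPair (vertexT ⊗ Table) x r') → Spine H1c r' t' →
               Eval H1c (qq ∷ q' ∷ θ0) tableCons H2 r mc →
               Spine H2 r (suc t') × mc ≤ 12 + consConst + (scanCost * suc t' + scanCost * suc t')
    tableCons-cost {H1c} {qq} {q'} {x} {r'} {t'} e4' sh
      (eApp (eSnd eVar e4) (eApp (eFst eVar e5) (eApp dl1 (eApp dl2 (eCon (eInr (ePair {H1 = H5} {p1 = pb} {p2 = pa} dbd eVar)))))))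
      = spCons (nth-alloc (alloc (alloc H5 (nPair (Univ ⊗ Table) pb pa)) (nInr (unit ⊕ (Univ ⊗ Table)) (length H5))) _)
               (nth-alloc₁ (alloc H5 (nPair (Univ ⊗ Table) pb pa)) _ _) (nth-alloc₂ H5 _ _ _)
               (spine-⊑ (⊑-trans (eval-⊑ dbd) ⊑-alloc₃) (spine-⊑ (eval-⊑ dl2) (spine-⊑ (eval-⊑ dl1) sh1)))
      , subst (_≤ 12 + consConst + (scanCost * suc t' + scanCost * suc t')) (sym (cons-arith _ _ _))
          (cons-bound
            (lookupTable-cost (there (here refl)) (firstAddress (here refl))
               (foldFree-firstAddress {vertexT ∷ Table ∷ (vertexT ⊗ Table) ∷ TableStepArg ∷ vtg ∷ Γ} (here refl)) sh1 dl1)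
            (lookupTable-cost (there (there (here refl))) (secondAddress (there (here refl)))
               (foldFree-secondAddress {Lookup ∷ vertexT ∷ Table ∷ (vertexT ⊗ Table) ∷ TableStepArg ∷ vtg ∷ Γ} (there (here refl)))
               (spine-⊑ (eval-⊑ dl1) sh1) dl2)
            (foldFree-cost _ (foldFree-buildVertex {BuildCtx} (there (there (here refl))) (there (here refl)) (here refl)) dbd))
      where
      pe = cong secondChild (nth-det {xs = H1c} {i = qq} e4 e4')
      sh1 = subst (λ z → Spine H1c z t') (sym pe) sh

    tableFold-cost : ∀ {H p H2 r m} → FoldEval θ0 vtgP tableStep H p H2 r m → TableRun H p H2 r m
    tableFold-cost (fStep e (mInl e' mK) db) = tableRun-nil e e' db
    tableFold-cost {H} {p} fd@(fStep {q = q} e md@(mInr {q2 = u} e' (mPair {q1 = x} {q2 = l} e'' mK (mId {H1 = H1a} {r = r'} {m = m'} fd'))) db) =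
      tableRun-cons db
      where
      IH = tableFold-cost fd'
      lR : Reach H p l
      lR = step (step (step root e (here refl)) e' (here refl)) e'' (there (here refl))
      H1b = alloc H1a (nPair (vertexT ⊗ Table) x r')
      H1c = alloc H1b (nInr TableStepArg (length H1a))
      m< : ∀ m2 → m' < suc (suc (suc (suc (suc m'))) + m2)
      m< m2 = s≤s (≤-trans (n≤1+n _) (≤-trans (n≤1+n _) (≤-trans (n≤1+n _) (≤-trans (n≤1+n _) (m≤m+n _ _)))))
      tableRun-cons : ∀ {H2 r m2} → Eval H1c (length H1b ∷ θ0) tableStep H2 r m2 →
                TableRun H p H2 r (suc (suc (suc (suc (suc m'))) + m2))
      tableRun-cons (eCaseL eVar e3 _) = case nth-det {xs = H1c} {i = length H1b} e3 (nth-alloc H1b _) of λ ()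
      tableRun-cons {H2} {r} {m2} db@(eCaseR {q = qq} {m = mc} eVar e3 dc) = record
        { t = suc (t IH)
        ; spine = proj₁ cs
        ; bound = tableBound-suc (t IH) (bound IH) costB
        ; cells = p ∷ cells IH
        ; cells-length = cong suc (cells-length IH)
        ; cells-unique = All.tabulate (λ {v} v∈ → neq v v∈) ∷ cells-unique IH
        ; cells-reach = λ { v (here refl) → root , (_ , _ , e) ; v (there i) → Reach-trans lR (proj₁ (cells-reach IH v i)) , proj₂ (cells-reach IH v i) }
        ; cells-fold = λ { v (here refl) → _ , _ , _ , fStep e md db , ≤-refl
                    ; v (there i) → let (a , b , c , d , f) = cells-fold IH v i in a , b , c , d , ≤-trans f (<⇒≤ (m< m2)) }
        }
        where
        qe : length H1a ≡ qq
        qe = cong firstChild (nth-det {xs = H1c} {i = length H1b} (nth-alloc H1b _) e3)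
        e4' : nth H1c qq ≡ just (nPair (vertexT ⊗ Table) x r')
        e4' = subst (λ z → nth H1c z ≡ just (nPair (vertexT ⊗ Table) x r')) qe (nth-alloc₁ H1a _ _)
        cs = tableCons-cost e4' (spine-⊑ (⊑-trans {H2 = H1b} ⊑-alloc ⊑-alloc) (spine IH)) dc
        X = scanCost * suc (t IH)
        costB : suc (suc (suc (suc (suc m'))) + suc (1 + mc)) ≤ m' + (stepConst + (X + X))
        costB = ≤-trans (s≤s (s≤s (s≤s (s≤s (s≤s (+-monoʳ-≤ m' (s≤s (s≤s (proj₂ cs))))))))) (≤-reflexive (eqc m' consConst X))
          where
          eqc : ∀ m' C X → suc (suc (suc (suc (suc (m' + suc (suc (12 + C + (X + X)))))))) ≡ m' + (19 + C + (X + X))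
          eqc = solve-∀
        -- By determinism, a later cell equal to p would have a fold as expensive as p's own, yet cheaper.
        neq : ∀ v → v ∈ cells IH → p ≢ v
        neq v v∈ eqv = case cells-fold IH v v∈ of λ { (_ , _ , m'' , fd'' , le) →
          <⇒≱ (m< m2) (≤-trans (≤-reflexive (cong Outcome.cost
                (foldEval-det (fStep e md db) (subst (λ z → FoldEval θ0 vtgP tableStep H z _ _ m'') (sym eqv) fd'')))) le) }

  open TableCost using (tableFold-cost; TableRun; tableConst)

  readRootSize : Ty → ℕ
  readRootSize γ = tmSize (readRoot {vtg ∷ []} γ (find∈ γ S))

  deserialize-arith : ∀ {m1 mh t s} e h → m1 ≤ e * (suc t * suc t) → mh ≤ h → suc t ≤ s →
            suc (1 + suc (suc (1 + m1) + mh)) ≤ (5 + h + e) * (suc s ^ 2)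
  deserialize-arith {m1} {mh} {t} {s} e h h1 h2 h3 =
    ≤-trans (≤-reflexive (eq1 m1 mh))
      (≤-trans (+-mono-≤ (≤-refl {5}) (+-mono-≤ h2 (≤-trans h1 (*-monoʳ-≤ e (*-mono-≤ (≤-trans h3 (n≤1+n s)) (≤-trans h3 (n≤1+n s)))))))
        (≤-trans (≤-reflexive (eq3 h (e * (suc s * suc s))))
          (≤-trans (+-mono-≤ (*-monoʳ-≤ (5 + h) (s≤s (z≤n {s + s * suc s}))) (≤-refl {e * (suc s * suc s)}))
            (≤-reflexive (eq2 h e s)))))
    where
    eq1 : ∀ m1 mh → suc (1 + suc (suc (1 + m1) + mh)) ≡ 5 + (mh + m1)
    eq1 = solve-∀
    eq3 : ∀ h x → 5 + (h + x) ≡ (5 + h) * 1 + x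
    eq3 = solve-∀
    eq2 : ∀ h e s → (5 + h) * (suc s * suc s) + e * (suc s * suc s) ≡ (5 + h + e) * (suc s * (suc s * 1))
    eq2 = solve-∀

  deserialize-cost : ∀ γ → TDPolyCost (deserialize γ)
  deserialize-cost γ = (5 + readRootSize γ + tableConst {[]} (0 ∷ [])) , 2 , cost-bound
    where
    cost-bound : ∀ H p s → WT H p vtg → Size H p s → ∀ H' r n →
          Eval {vtg ∷ []} H (p ∷ []) (app (wkFun (deserialize γ)) (var (here refl))) H' r n →
          n ≤ (5 + readRootSize γ + tableConst {[]} (0 ∷ [])) * (suc s ^ 2)
    cost-bound H p s wt (xs , u , f1 , f2 , len) H' r n (eApp eVar d2) = go (eval-unren (RenEnv-ext p (λ ())) (deserializeBody γ) d2)
      where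
      go : ∀ {m} → Eval H (p ∷ []) (deserializeBody γ) H' r m → suc (1 + m) ≤ (5 + readRootSize γ + tableConst {[]} (0 ∷ [])) * (suc s ^ 2)
      go (eApp (eFold eVar fd) dh) =
        deserialize-arith (tableConst {[]} (0 ∷ [])) (readRootSize γ) (TableRun.bound R) (foldFree-cost _ (foldFree-readRoot {vtg ∷ []} γ (find∈ γ S)) dh)
          (subst₂ _≤_ (TableRun.cells-length R) len
            (unique-length-≤ (TableRun.cells R) xs (TableRun.cells-unique R) (λ v v∈ → f2 v (proj₁ (TableRun.cells-reach R v v∈)) (proj₂ (TableRun.cells-reach R v v∈)))))
        where
        R = tableFold-cost (p ∷ []) fd

-- Correctness

decNat-⊑ : ∀ {H H' p n} → H ⊑ H' → DecNat H p n → DecNat H' p n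
decNat-⊑ x (dZero e1 e2) = dZero (nth-⊑ x e1) (nth-⊑ x e2)
decNat-⊑ x (dSuc e1 e2 d) = dSuc (nth-⊑ x e1) (nth-⊑ x e2) (decNat-⊑ x d)

decBool-⊑ : ∀ {H H' p b} → H ⊑ H' → DecBool H p b → DecBool H' p b
decBool-⊑ x (dFalse e) = dFalse (nth-⊑ x e)
decBool-⊑ x (dTrue e) = dTrue (nth-⊑ x e)

decStr-⊑ : ∀ {H H' p s} → H ⊑ H' → DecStr H p s → DecStr H' p s
decStr-⊑ x (dNil e1 e2) = dNil (nth-⊑ x e1) (nth-⊑ x e2)
decStr-⊑ x (dCons e1 e2 e3 b d) = dCons (nth-⊑ x e1) (nth-⊑ x e2) (nth-⊑ x e3) (decBool-⊑ x b) (decStr-⊑ x d)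

decSN-⊑ : ∀ {H H' p s n} → H ⊑ H' → DecSN H p s n → DecSN H' p s n
decSN-⊑ x (dSN e d1 d2) = dSN (nth-⊑ x e) (decStr-⊑ x d1) (decNat-⊑ x d2)

decVertex-⊑ : ∀ {H H' p i} → H ⊑ H' → DecVertex H p i → DecVertex H' p i
decVertex-⊑ x (dVUnit e1 e2) = dVUnit (nth-⊑ x e1) (nth-⊑ x e2)
decVertex-⊑ x (dVInl e1 e2 e3 d) = dVInl (nth-⊑ x e1) (nth-⊑ x e2) (nth-⊑ x e3) (decSN-⊑ x d)
decVertex-⊑ x (dVInr e1 e2 e3 e4 d) = dVInr (nth-⊑ x e1) (nth-⊑ x e2) (nth-⊑ x e3) (nth-⊑ x e4) (decSN-⊑ x d)
decVertex-⊑ x (dVPair e1 e2 e3 e4 e5 e6 e7 d1 d2 d3) =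
  dVPair (nth-⊑ x e1) (nth-⊑ x e2) (nth-⊑ x e3) (nth-⊑ x e4) (nth-⊑ x e5) (nth-⊑ x e6) (nth-⊑ x e7)
         (decStr-⊑ x d1) (decNat-⊑ x d2) (decNat-⊑ x d3)
decVertex-⊑ x (dVMu e1 e2 e3 e4 e5 d) = dVMu (nth-⊑ x e1) (nth-⊑ x e2) (nth-⊑ x e3) (nth-⊑ x e4) (nth-⊑ x e5) (decSN-⊑ x d)

data DecTable (H : Heap) : ℕ → List ℕ → Set where
  tNil : ∀ {p γ δ q u} → nth H p ≡ just (nCon γ q) → nth H q ≡ just (nInl δ u) → DecTable H p []
  tCons : ∀ {p γ δ ε q u x l es} → nth H p ≡ just (nCon γ q) → nth H q ≡ just (nInr δ u) →
          nth H u ≡ just (nPair ε x l) → DecTable H l es → DecTable H p (x ∷ es)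

decTable-⊑ : ∀ {H H' p es} → H ⊑ H' → DecTable H p es → DecTable H' p es
decTable-⊑ x (tNil e1 e2) = tNil (nth-⊑ x e1) (nth-⊑ x e2)
decTable-⊑ x (tCons e1 e2 e3 a) = tCons (nth-⊑ x e1) (nth-⊑ x e2) (nth-⊑ x e3) (decTable-⊑ x a)

data ScanState (H : Heap) (p : ℕ) (es : List ℕ) (a : ℕ) : Set where
  scanCounting : ∀ {γ δ ε pc pf pn u k} → nth H p ≡ just (nPair γ pc pf) → nth H pc ≡ just (nInl δ pn) →
          DecNat H pn k → length es + k ≡ a → nth H pf ≡ just (nInr ε u) → ScanState H p es a
  scanFound : ∀ {γ δ ε pc pf u e} → nth H p ≡ just (nPair γ pc pf) → nth H pc ≡ just (nInr δ u) →
            nth H pf ≡ just (nInl ε e) → nth (reverse es) a ≡ just e → ScanState H p es a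

data LookupResult (H : Heap) (pl : ℕ) : Maybe ℕ → Set where
  lrFound : ∀ {γ e} → nth H pl ≡ just (nInl γ e) → LookupResult H pl (just e)
  lrMissing : ∀ {γ u} → nth H pl ≡ just (nInr γ u) → LookupResult H pl nothing

lookupResult-⊑ : ∀ {H H' p m} → H ⊑ H' → LookupResult H p m → LookupResult H' p m
lookupResult-⊑ x (lrFound e) = lrFound (nth-⊑ x e)
lookupResult-⊑ x (lrMissing e) = lrMissing (nth-⊑ x e)

EvalsTo : ∀ {Γ a} → Heap → Env Γ → Tm Γ a → (Heap → ℕ → Set) → Set
EvalsTo H θ t P = Σ Heap λ H' → Σ ℕ λ r → Σ ℕ λ m → Eval H θ t H' r m × H ⊑ H' × P H' r

module LookupCorrect (S : List Ty) where
  open Deserializer S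

  scanStep-correct : ∀ {Γ} {θ : Env Γ} {H1 x sp es a} pa → ScanState H1 sp es a →
    Σ Heap λ H' → Σ ℕ λ sp' → Σ ℕ λ m →
      Eval {TableP ⟦ Scan ⟧ ∷ natT ∷ Γ} (alloc (alloc H1 (nPair (Univ ⊗ Scan) x sp)) (nInr (unit ⊕ (Univ ⊗ Scan)) (length H1)))
           (length (alloc H1 (nPair (Univ ⊗ Scan) x sp)) ∷ pa ∷ θ) scanStep H' sp' m
      × (alloc (alloc H1 (nPair (Univ ⊗ Scan) x sp)) (nInr (unit ⊕ (Univ ⊗ Scan)) (length H1))) ⊑ H' × ScanState H' sp' (x ∷ es) a
  scanStep-correct {Γ} {θ} {H1} {x} {sp} {es} {a} pa (scanCounting {pc = pc} {pf = pf} {pn = pn} ep epc (dZero {q = q} {u = u'} n1 n2) len epf) =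
    K4 , length K3 , _ , eCaseR eVar (nth-alloc H1b _) (eCaseL (eFst (eSnd eVar prE) (X ep)) (X epc) (eCaseL (eDes eVar (X n1)) (X n2) dA)) ,
    eval-⊑ dA ,
    scanFound (nth-alloc K3 _) (nth-alloc₂ K1 _ _ _) (nth-alloc₁ K2 _ _) (subst (λ z → nth (reverse (x ∷ es)) z ≡ just x) (trans (sym (+-identityʳ _)) len) (nth-reverse-last x es))
    where
    H1b = alloc H1 (nPair (Univ ⊗ Scan) x sp)
    H1c = alloc H1b (nInr (unit ⊕ (Univ ⊗ Scan)) (length H1))
    X : ∀ {q n} → nth H1 q ≡ just n → nth H1c q ≡ just n
    X = nth-⊑ {H = H1} ⊑-alloc₂
    prE : nth H1c (length H1) ≡ just (nPair (Univ ⊗ Scan) x sp)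
    prE = nth-alloc₁ H1 _ _
    K1 = alloc H1c nUnit
    K2 = alloc K1 (nInr Counter (length H1c))
    K3 = alloc K2 (nInl Lookup x)
    K4 = alloc K3 (nPair Scan (length K1) (length K2))
    dA : Eval H1c (u' ∷ pn ∷ length H1 ∷ length H1b ∷ pa ∷ θ) (pair (inr ⟨⟩) (inl (fst v2))) K4 (length K3) _
    dA = ePair (eInr eUnit) (eInl (eFst eVar (nth-⊑ {H = H1c} ⊑-alloc₂ prE)))
  scanStep-correct {Γ} {θ} {H1} {x} {sp} {es} {a} pa (scanCounting {pc = pc} {pf = pf} {pn = pn} ep epc (dSuc {q = q} {u = u'} {n = k'} n1 n2 dn) len epf) =
    K2 , length K1 , _ , eCaseR eVar (nth-alloc H1b _) (eCaseL (eFst (eSnd eVar prE) (X ep)) (X epc) (eCaseR (eDes eVar (X n1)) (X n2) dB)) ,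
    eval-⊑ dB ,
    scanCounting (nth-alloc K1 _) (nth-⊑ {H = K1} ⊑-alloc (nth-alloc H1c _)) (decNat-⊑ (⊑-trans (⊑-alloc₂ {H1}) (eval-⊑ dB)) dn)
          (trans (sym (+-suc (length es) k')) len) (nth-⊑ (⊑-trans (⊑-alloc₂ {H1}) (eval-⊑ dB)) epf)
    where
    H1b = alloc H1 (nPair (Univ ⊗ Scan) x sp)
    H1c = alloc H1b (nInr (unit ⊕ (Univ ⊗ Scan)) (length H1))
    X : ∀ {q n} → nth H1 q ≡ just n → nth H1c q ≡ just n
    X = nth-⊑ {H = H1} ⊑-alloc₂
    prE : nth H1c (length H1) ≡ just (nPair (Univ ⊗ Scan) x sp)
    prE = nth-alloc₁ H1 _ _
    K1 = alloc H1c (nInl Counter u')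
    K2 = alloc K1 (nPair Scan (length H1c) pf)
    dB : Eval H1c (u' ∷ pn ∷ length H1 ∷ length H1b ∷ pa ∷ θ) (pair (inl v0) (snd (snd v2))) K2 (length K1) _
    dB = ePair (eInl eVar) (eSnd (eSnd eVar (nth-⊑ {H = H1c} ⊑-alloc prE)) (nth-⊑ {H = H1} ⊑-alloc₃ ep))
  scanStep-correct {Γ} {θ} {H1} {x} {sp} {es} {a} pa (scanFound {pc = pc} {pf = pf} {u = u} ep epc epf enth) =
    K3 , length K2 , _ , eCaseR eVar (nth-alloc H1b _) (eCaseR (eFst (eSnd eVar prE) (X ep)) (X epc) dC) ,
    eval-⊑ dC ,
    scanFound (nth-alloc K2 _) (nth-⊑ {H = K2} ⊑-alloc (nth-alloc K1 _)) (nth-⊑ (⊑-trans (⊑-alloc₂ {H1}) (eval-⊑ dC)) epf) (nth-reverse-∷ x es enth)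
    where
    H1b = alloc H1 (nPair (Univ ⊗ Scan) x sp)
    H1c = alloc H1b (nInr (unit ⊕ (Univ ⊗ Scan)) (length H1))
    X : ∀ {q n} → nth H1 q ≡ just n → nth H1c q ≡ just n
    X = nth-⊑ {H = H1} ⊑-alloc₂
    prE : nth H1c (length H1) ≡ just (nPair (Univ ⊗ Scan) x sp)
    prE = nth-alloc₁ H1 _ _
    K1 = alloc H1c nUnit
    K2 = alloc K1 (nInr Counter (length H1c))
    K3 = alloc K2 (nPair Scan (length K1) pf)
    dC : Eval H1c (u ∷ length H1 ∷ length H1b ∷ pa ∷ θ) (pair (inr ⟨⟩) (snd (snd v1))) K3 (length K2) _
    dC = ePair (eInr eUnit) (eSnd (eSnd eVar (nth-⊑ {H = H1c} ⊑-alloc₂ prE)) (nth-⊑ {H = H1} ⊑-alloc₄ ep))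

  scanFold-correct : ∀ {Γ} {θ : Env Γ} {H p es pa a} → DecTable H p es → DecNat H pa a →
    Σ Heap λ H' → Σ ℕ λ sp → Σ ℕ λ m → FoldEval {natT ∷ Γ} (pa ∷ θ) TableP scanStep H p H' sp m × H ⊑ H' × ScanState H' sp es a
  scanFold-correct {Γ} {θ} {H} {p} {[]} {pa} {a} (tNil {u = u} e1 e2) dn =
    H5 , length H4 , _ , fStep e1 (mInl e2 mK) (eCaseL eVar (nth-alloc H _) dp) , ⊑-trans ⊑-alloc (eval-⊑ dp) ,
    scanCounting (nth-alloc H4 _) (nth-⊑ {H = H2} ⊑-alloc₃ (nth-alloc H1 _))
          (decNat-⊑ (⊑-trans {H2 = H1} ⊑-alloc (eval-⊑ dp)) dn) refl
          (nth-alloc₁ H3 _ _)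
    where
    H1 = alloc H (nInl (unit ⊕ (Univ ⊗ Scan)) u)
    H2 = alloc H1 (nInl Counter pa)
    H3 = alloc H2 nUnit
    H4 = alloc H3 (nInr Lookup (length H2))
    H5 = alloc H4 (nPair Scan (length H1) (length H3))
    dp : Eval H1 (u ∷ length H ∷ pa ∷ θ) (pair (inl v2) (inr ⟨⟩)) H5 (length H4) _
    dp = ePair (eInl eVar) (eInr eUnit)
  scanFold-correct {Γ} {θ} {H} {p} {x ∷ es} {pa} {a} (tCons {q = q} {u = u} {l = l} e1 e2 e3 acc) dn
    with scanFold-correct {θ = θ} acc dn
  ... | H1 , sp , m' , fd , ext1 , st with scanStep-correct {θ = θ} {x = x} pa st
  ... | H' , sp' , m2 , db , ext2 , st' =
    H' , sp' , _ , fStep e1 (mInr e2 (mPair e3 mK (mId fd))) db , ⊑-trans ext1 (⊑-trans (⊑-trans ⊑-alloc ⊑-alloc) ext2) , st'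

  lookupTable-correct : ∀ {Γ} (acc : Table ∈ Γ) (addr : Tm Γ natT) {H θ es H1 pa na a} → DecTable H (All.lookup θ acc) es →
             Eval H θ addr H1 pa na → DecNat H1 pa a →
             EvalsTo H θ (lookupTable acc addr) (λ H' pl → LookupResult H' pl (nth (reverse es) a))
  lookupTable-correct acc addr {H} {θ} {es} {H1} {pa} {na} {a} ac da dn with scanFold-correct {θ = θ} (decTable-⊑ (eval-⊑ da) ac) dn
  ... | H2 , sp , m , fd , ext , scanCounting {pf = pf} {k = k} ep epc dn' len epf =
    H2 , pf , _ , eApp da (eSnd (eFold eVar fd) ep) , ⊑-trans (eval-⊑ da) ext ,
    subst (LookupResult H2 pf) (sym (nth-reverse-≥ es (subst (length es ≤_) len (m≤m+n (length es) k)))) (lrMissing epf)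
  ... | H2 , sp , m , fd , ext , scanFound {pf = pf} ep epc epf enth =
    H2 , pf , _ , eApp da (eSnd (eFold eVar fd) ep) , ⊑-trans (eval-⊑ da) ext ,
    subst (LookupResult H2 pf) (sym enth) (lrFound epf)

bitsEq : List Bool → List Bool → Bool
bitsEq [] [] = true
bitsEq [] (_ ∷ _) = false
bitsEq (_ ∷ _) [] = false
bitsEq (b ∷ bs) (false ∷ cs) = if b then false else bitsEq bs cs
bitsEq (b ∷ bs) (true ∷ cs) = if b then bitsEq bs cs else false

bitsEq-refl : ∀ cs → bitsEq cs cs ≡ true
bitsEq-refl [] = refl
bitsEq-refl (false ∷ cs) = bitsEq-refl cs
bitsEq-refl (true ∷ cs) = bitsEq-refl cs

bitsEq-sound : ∀ bs cs → bitsEq bs cs ≡ true → bs ≡ cs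
bitsEq-sound [] [] e = refl
bitsEq-sound [] (x ∷ cs) ()
bitsEq-sound (x ∷ bs) [] ()
bitsEq-sound (false ∷ bs) (false ∷ cs) e = cong (false ∷_) (bitsEq-sound bs cs e)
bitsEq-sound (true ∷ bs) (false ∷ cs) ()
bitsEq-sound (false ∷ bs) (true ∷ cs) ()
bitsEq-sound (true ∷ bs) (true ∷ cs) e = cong (true ∷_) (bitsEq-sound bs cs e)

data BoolAt (H : Heap) (r : ℕ) : Bool → Set where
  boolFalse : ∀ {γ u} → nth H r ≡ just (nInl γ u) → BoolAt H r false
  boolTrue : ∀ {γ u} → nth H r ≡ just (nInr γ u) → BoolAt H r true

equalsString-correct : ∀ {Δ} (x : stringT ∈ Δ) (c : List Bool) {H θ bs} → DecStr H (All.lookup θ x) bs →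
          EvalsTo H θ (equalsString x c) (λ H' r → BoolAt H' r (bitsEq bs c))
equalsString-correct x [] {H} (dNil e1 e2) = _ , _ , _ , eCaseL (eDes eVar e1) e2 (eInr eUnit) , ⊑-alloc₂ , boolTrue (nth-alloc (alloc H nUnit) _)
equalsString-correct x [] {H} (dCons e1 e2 e3 b d) = _ , _ , _ , eCaseR (eDes eVar e1) e2 (eInl eUnit) , ⊑-alloc₂ , boolFalse (nth-alloc (alloc H nUnit) _)
equalsString-correct x (false ∷ c) {H} (dNil e1 e2) = _ , _ , _ , eCaseL (eDes eVar e1) e2 (eInl eUnit) , ⊑-alloc₂ , boolFalse (nth-alloc (alloc H nUnit) _)
equalsString-correct x (false ∷ c) {H} (dCons e1 e2 e3 (dFalse eb) d) with equalsString-correct (here refl) c d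
... | H' , r , m , dr , ex , bl = H' , r , _ , eCaseR (eDes eVar e1) e2 (eCaseL (eFst eVar e3) eb (eApp (eSnd eVar e3) dr)) , ex , bl
equalsString-correct x (false ∷ c) {H} (dCons e1 e2 e3 (dTrue eb) d) = _ , _ , _ , eCaseR (eDes eVar e1) e2 (eCaseR (eFst eVar e3) eb (eInl eUnit)) , ⊑-alloc₂ , boolFalse (nth-alloc (alloc H nUnit) _)
equalsString-correct x (true ∷ c) {H} (dNil e1 e2) = _ , _ , _ , eCaseL (eDes eVar e1) e2 (eInl eUnit) , ⊑-alloc₂ , boolFalse (nth-alloc (alloc H nUnit) _)
equalsString-correct x (true ∷ c) {H} (dCons e1 e2 e3 (dFalse eb) d) = _ , _ , _ , eCaseR (eDes eVar e1) e2 (eCaseL (eFst eVar e3) eb (eInl eUnit)) , ⊑-alloc₂ , boolFalse (nth-alloc (alloc H nUnit) _)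
equalsString-correct x (true ∷ c) {H} (dCons e1 e2 e3 (dTrue eb) d) with equalsString-correct (here refl) c d
... | H' , r , m , dr , ex , bl = H' , r , _ , eCaseR (eDes eVar e1) e2 (eCaseR (eFst eVar e3) eb (eApp (eSnd eVar e3) dr)) , ex , bl

data InSum (H : Heap) {τ : Ty} : ∀ {xs} → τ ∈ xs → ℕ → ℕ → Set where
  inHere : ∀ {xs p γ b} → nth H p ≡ just (nInl γ b) → InSum H {xs = τ ∷ xs} (here refl) p b
  inThere : ∀ {x xs i p γ p' b} → nth H p ≡ just (nInr γ p') → InSum H {xs = xs} i p' b → InSum H {xs = x ∷ xs} (there i) p b

inSum-⊑ : ∀ {H H' τ xs} {i : τ ∈ xs} {p b} → H ⊑ H' → InSum H i p b → InSum H' i p b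
inSum-⊑ x (inHere e) = inHere (nth-⊑ x e)
inSum-⊑ x (inThere e u) = inThere (nth-⊑ x e) (inSum-⊑ x u)

projSum-correct : ∀ {Δ τ} xs (i : τ ∈ xs) (u : SumOf xs ∈ Δ) {H θ b} → InSum H i (All.lookup θ u) b →
         Σ ℕ λ m → Eval H θ (projSum xs i u) H b m
projSum-correct (x ∷ xs) (here refl) u (inHere e) = _ , eCaseL eVar e eVar
projSum-correct (x ∷ xs) (there i) u (inThere e ui) with projSum-correct xs i (here refl) ui
... | m , d = _ , eCaseR eVar e d

injSum-correct : ∀ {Δ τ xs} (i : τ ∈ xs) (t : Tm Δ τ) {H θ H1 b m} → Eval H θ t H1 b m →
         EvalsTo H θ (injSum i t) (λ H' p → InSum H' i p b × H1 ⊑ H')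
injSum-correct (here refl) t {H1 = H1} d = _ , _ , _ , eInl d , ⊑-trans (eval-⊑ d) ⊑-alloc , inHere (nth-alloc H1 _) , ⊑-alloc
injSum-correct (there i) t d with injSum-correct i t d
... | H2 , p2 , m2 , d2 , ex , ui , ex1 =
  _ , _ , _ , eInr d2 , ⊑-trans ex ⊑-alloc , inThere (nth-alloc H2 _) (inSum-⊑ ⊑-alloc ui) , ⊑-trans ex1 ⊑-alloc

module DispatchCorrect (S : List Ty) where
  open Deserializer S

  extract-correct : ∀ {Δ τ} (i : τ ∈ S) (l : Lookup ∈ Δ) {H θ γ e b} → nth H (All.lookup θ l) ≡ just (nInl γ e) → InSum H i e b →
              Σ ℕ λ m → Eval H θ (extract i l) H b m
  extract-correct i l e ui with projSum-correct S i (here refl) ui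
  ... | m , d = _ , eCaseL eVar e d

  dispatch-correct : ∀ (info : Ty → Maybe Maker) τs {Δ} (s : stringT ∈ Δ) (l1 l2 : Lookup ∈ Δ) {H θ τ0} (mk0 : Maker) (P : Heap → ℕ → Set) →
          DecStr H (All.lookup θ s) (enc τ0) → τ0 ∈ τs → info τ0 ≡ just mk0 →
          (∀ {Δ'} (θ' : Env Δ') (l1' l2' : Lookup ∈ Δ') H' → H ⊑ H' → All.lookup θ' l1' ≡ All.lookup θ l1 →
             All.lookup θ' l2' ≡ All.lookup θ l2 → EvalsTo H' θ' (mk0 l1' l2') P) →
          EvalsTo H θ (dispatch info τs s l1 l2) P
  dispatch-correct info (τ ∷ τs) s l1 l2 {H} {θ} {τ0} mk0 P ds mem ei ok with info τ in eq
  ... | nothing with mem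
  ... | here refl with trans (sym ei) eq
  ... | ()
  dispatch-correct info (τ ∷ τs) s l1 l2 {H} {θ} {τ0} mk0 P ds mem ei ok | nothing | there mem' = dispatch-correct info τs s l1 l2 mk0 P ds mem' ei ok
  dispatch-correct info (τ ∷ τs) s l1 l2 {H} {θ} {τ0} mk0 P ds mem ei ok | just mk with equalsString-correct s (enc τ) ds
  ... | H1 , r , m , dr , ex , bl = go (bitsEq (enc τ0) (enc τ)) refl bl mem
    where
    go : ∀ b → bitsEq (enc τ0) (enc τ) ≡ b → BoolAt H1 r b → τ0 ∈ (τ ∷ τs) → EvalsTo H θ (case (equalsString s (enc τ)) (dispatch info τs (there s) (there l1) (there l2)) (mk (there l1) (there l2))) P
    go true e (boolTrue {u = u} et) _ with enc-injective τ0 τ (bitsEq-sound _ _ e)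
    ... | refl with trans (sym ei) eq
    ... | refl with ok (u ∷ θ) (there l1) (there l2) H1 ex refl refl
    ... | H2 , r2 , m2 , d2 , ex2 , p2 = H2 , r2 , _ , eCaseR dr et d2 , ⊑-trans ex ex2 , p2
    go false e (boolFalse {u = u} ef) (here refl) with trans (sym e) (bitsEq-refl (enc τ))
    ... | ()
    go false e (boolFalse {u = u} ef) (there mem') with dispatch-correct info τs (there s) (there l1) (there l2) {H1} {u ∷ θ} mk0 P (decStr-⊑ ex ds) mem' ei
                                                  (λ θ' l1' l2' H' ex' e1 e2 → ok θ' l1' l2' H' (⊑-trans ex ex') e1 e2)
    ... | H2 , r2 , m2 , d2 , ex2 , p2 = H2 , r2 , _ , eCaseL dr ef d2 , ⊑-trans ex ex2 , p2

data NodeWT (H : Heap) : Node → Ty → Set where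
  nwUnit : NodeWT H nUnit unit
  nwInl  : ∀ {a b c} → WT H c a → NodeWT H (nInl (a ⊕ b) c) (a ⊕ b)
  nwInr  : ∀ {a b c} → WT H c b → NodeWT H (nInr (a ⊕ b) c) (a ⊕ b)
  nwPair : ∀ {a b c d} → WT H c a → WT H d b → NodeWT H (nPair (a ⊗ b) c d) (a ⊗ b)
  nwCon  : ∀ {P w c} → WT H c (P ⟦ μ P w ⟧) → NodeWT H (nCon (μ P w) c) (μ P w)

WT-nth : ∀ {H p τ} → WT H p τ → Σ Node λ n → nth H p ≡ just n
WT-nth (wtUnit e)     = _ , e
WT-nth (wtInl e _)    = _ , e
WT-nth (wtInr e _)    = _ , e
WT-nth (wtPair e _ _) = _ , e
WT-nth (wtCon e _)    = _ , e

WT-node : ∀ {H p τ n} → WT H p τ → nth H p ≡ just n → NodeWT H n τ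
WT-node {H} {p} (wtUnit e) e' with nth-det {xs = H} {i = p} e e'
... | refl = nwUnit
WT-node {H} {p} (wtInl e w) e' with nth-det {xs = H} {i = p} e e'
... | refl = nwInl w
WT-node {H} {p} (wtInr e w) e' with nth-det {xs = H} {i = p} e e'
... | refl = nwInr w
WT-node {H} {p} (wtPair e w w') e' with nth-det {xs = H} {i = p} e e'
... | refl = nwPair w w'
WT-node {H} {p} (wtCon e w) e' with nth-det {xs = H} {i = p} e e'
... | refl = nwCon w

NodeWT-unique : ∀ {H n τ τ'} → NodeWT H n τ → NodeWT H n τ' → τ ≡ τ'
NodeWT-unique nwUnit       nwUnit       = refl
NodeWT-unique (nwInl _)    (nwInl _)    = refl
NodeWT-unique (nwInr _)    (nwInr _)    = refl
NodeWT-unique (nwPair _ _) (nwPair _ _) = refl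
NodeWT-unique (nwCon _)    (nwCon _)    = refl

WT-unique : ∀ {H p τ τ'} → WT H p τ → WT H p τ' → τ ≡ τ'
WT-unique w w' = let _ , e = WT-nth w in NodeWT-unique (WT-node w e) (WT-node w' e)

WT-child : ∀ {H p τ n c} → WT H p τ → nth H p ≡ just n → c ∈ children n → Σ Ty λ x → WT H c x × x ∈ childTypes τ
WT-child w e = NodeWT-child (WT-node w e)
  where
  NodeWT-child : ∀ {H n τ c} → NodeWT H n τ → c ∈ children n → Σ Ty λ x → WT H c x × x ∈ childTypes τ
  NodeWT-child (nwInl w)    (here refl)         = _ , w , here refl
  NodeWT-child (nwInr w)    (here refl)         = _ , w , there (here refl)
  NodeWT-child (nwPair w _) (here refl)         = _ , w , here refl
  NodeWT-child (nwPair _ w) (there (here refl)) = _ , w , there (here refl)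
  NodeWT-child (nwCon w)    (here refl)         = _ , w , here refl

nodeMap-⊑ : ∀ {φ x H H' q} → H ⊑ H' → NodeMap φ x (nth H q) → NodeMap φ x (nth H' q)
nodeMap-⊑ {H = H} {q = q} ex nm with nth H q in eq
nodeMap-⊑ ex mUnit | just _ rewrite nth-⊑ ex eq = mUnit
nodeMap-⊑ ex mInl | just _ rewrite nth-⊑ ex eq = mInl
nodeMap-⊑ ex mInr | just _ rewrite nth-⊑ ex eq = mInr
nodeMap-⊑ ex mPair | just _ rewrite nth-⊑ ex eq = mPair
nodeMap-⊑ ex mCon | just _ rewrite nth-⊑ ex eq = mCon

mapNode : (ℕ → ℕ) → Node → Node
mapNode f nUnit = nUnit
mapNode f (nInl γ c) = nInl γ (f c)
mapNode f (nInr γ c) = nInr γ (f c)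
mapNode f (nPair γ c d) = nPair γ (f c) (f d)
mapNode f (nCon γ c) = nCon γ (f c)

nodeMap-just : ∀ {φ n y} → NodeMap φ (just n) y → y ≡ just (mapNode φ n)
nodeMap-just mUnit = refl
nodeMap-just mInl = refl
nodeMap-just mInr = refl
nodeMap-just mPair = refl
nodeMap-just mCon = refl

nodeMap-intro : ∀ {φ n y} → y ≡ just (mapNode φ n) → NodeMap φ (just n) y
nodeMap-intro {n = nUnit} refl = mUnit
nodeMap-intro {n = nInl x x₁} refl = mInl
nodeMap-intro {n = nInr x x₁} refl = mInr
nodeMap-intro {n = nPair x x₁ x₂} refl = mPair
nodeMap-intro {n = nCon x x₁} refl = mCon

mapNode-cong : ∀ {f g} n → (∀ c → c ∈ children n → f c ≡ g c) → mapNode f n ≡ mapNode g n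
mapNode-cong nUnit h = refl
mapNode-cong (nInl x c) h rewrite h c (here refl) = refl
mapNode-cong (nInr x c) h rewrite h c (here refl) = refl
mapNode-cong (nPair x c d) h rewrite h c (here refl) | h d (there (here refl)) = refl
mapNode-cong (nCon x c) h rewrite h c (here refl) = refl

children-map : ∀ {f c} n → c ∈ children n → f c ∈ children (mapNode f n)
children-map (nInl x x₁) (here refl) = here refl
children-map (nInr x x₁) (here refl) = here refl
children-map (nPair x x₁ x₂) (here refl) = here refl
children-map (nPair x x₁ x₂) (there (here refl)) = there (here refl)
children-map (nCon x x₁) (here refl) = here refl

children-unmap : ∀ {f c'} n → c' ∈ children (mapNode f n) → Σ ℕ λ c → c ∈ children n × f c ≡ c'
children-unmap (nInl x x₁) (here refl) = _ , here refl , refl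
children-unmap (nInr x x₁) (here refl) = _ , here refl , refl
children-unmap (nPair x x₁ x₂) (here refl) = _ , here refl , refl
children-unmap (nPair x x₁ x₂) (there (here refl)) = _ , there (here refl) , refl
children-unmap (nCon x x₁) (here refl) = _ , here refl , refl

module BuildCorrect (S : List Ty) where
  open Deserializer S
  open DispatchCorrect S

  BuiltAt : ∀ {τ} → Heap → τ ∈ S → Node → Heap → ℕ → Set
  BuiltAt Hs i node H' p = Σ ℕ λ bn → InSum H' i p bn × nth H' bn ≡ just node × length Hs ≤ bn

  MakerCorrect : ∀ {Δ} → Heap → Env Δ → Lookup ∈ Δ → Lookup ∈ Δ → Maker → (Heap → ℕ → Set) → Set
  MakerCorrect {Δ} H θ l1 l2 mk0 P = ∀ {Δ'} (θ' : Env Δ') (l1' l2' : Lookup ∈ Δ') H' → H ⊑ H' → All.lookup θ' l1' ≡ All.lookup θ l1 →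
             All.lookup θ' l2' ≡ All.lookup θ l2 → EvalsTo H' θ' (mk0 l1' l2') P

  inlMaker-≡ : ∀ {a b} {i : (a ⊕ b) ∈ S} {ia : a ∈ S} → find∈ (a ⊕ b) S ≡ just i → find∈ a S ≡ just ia →
               inlMaker (a ⊕ b) ≡ just (λ l1 l2 → injSum i (inl (extract ia l1)))
  inlMaker-≡ {a} {b} e1 e2 rewrite e1 | e2 = refl

  inrMaker-≡ : ∀ {a b} {i : (a ⊕ b) ∈ S} {ib : b ∈ S} → find∈ (a ⊕ b) S ≡ just i → find∈ b S ≡ just ib →
               inrMaker (a ⊕ b) ≡ just (λ l1 l2 → injSum i (inr (extract ib l1)))
  inrMaker-≡ {a} {b} e1 e2 rewrite e1 | e2 = refl

  pairMaker-≡ : ∀ {a b} {i : (a ⊗ b) ∈ S} {ia : a ∈ S} {ib : b ∈ S} → find∈ (a ⊗ b) S ≡ just i → find∈ a S ≡ just ia → find∈ b S ≡ just ib →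
               pairMaker (a ⊗ b) ≡ just (λ l1 l2 → injSum i (pair (extract ia l1) (extract ib l2)))
  pairMaker-≡ {a} {b} e1 e2 e3 rewrite e1 | e2 | e3 = refl

  conMaker-≡ : ∀ {P w} {i : μ P w ∈ S} {ic : (P ⟦ μ P w ⟧) ∈ S} → find∈ (μ P w) S ≡ just i → find∈ (P ⟦ μ P w ⟧) S ≡ just ic →
               conMaker (μ P w) ≡ just (λ l1 l2 → injSum i (con P w (extract ic l1)))
  conMaker-≡ {P} {w} e1 e2 rewrite e1 | e2 = refl

  inlMaker-correct : ∀ {Δ a b} {i : (a ⊕ b) ∈ S} {ia : a ∈ S} {H θ} (l1 l2 : Lookup ∈ Δ) {γ e c} →
            nth H (All.lookup θ l1) ≡ just (nInl γ e) → InSum H ia e c →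
            MakerCorrect H θ l1 l2 (λ l1 l2 → injSum i (inl (extract ia l1))) (BuiltAt H i (nInl (a ⊕ b) c))
  inlMaker-correct {i = i} {ia} {H} l1 l2 ef ui θ' l1' l2' H' ex e1 e2
    with extract-correct ia l1' (subst (λ z → nth H' z ≡ _) (sym e1) (nth-⊑ ex ef)) (inSum-⊑ ex ui)
  ... | m , dx with injSum-correct i _ (eInl dx)
  ... | H2 , p2 , m2 , d2 , ex2 , ui2 , ex3 = H2 , p2 , m2 , d2 , ex2 , length H' , ui2 , nth-⊑ ex3 (nth-alloc H' _) , ⊑-length ex

  inrMaker-correct : ∀ {Δ a b} {i : (a ⊕ b) ∈ S} {ib : b ∈ S} {H θ} (l1 l2 : Lookup ∈ Δ) {γ e c} →
            nth H (All.lookup θ l1) ≡ just (nInl γ e) → InSum H ib e c →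
            MakerCorrect H θ l1 l2 (λ l1 l2 → injSum i (inr (extract ib l1))) (BuiltAt H i (nInr (a ⊕ b) c))
  inrMaker-correct {i = i} {ib} {H} l1 l2 ef ui θ' l1' l2' H' ex e1 e2
    with extract-correct ib l1' (subst (λ z → nth H' z ≡ _) (sym e1) (nth-⊑ ex ef)) (inSum-⊑ ex ui)
  ... | m , dx with injSum-correct i _ (eInr dx)
  ... | H2 , p2 , m2 , d2 , ex2 , ui2 , ex3 = H2 , p2 , m2 , d2 , ex2 , length H' , ui2 , nth-⊑ ex3 (nth-alloc H' _) , ⊑-length ex

  pairMaker-correct : ∀ {Δ a b} {i : (a ⊗ b) ∈ S} {ia : a ∈ S} {ib : b ∈ S} {H θ} (l1 l2 : Lookup ∈ Δ) {γ γ' e e' c c'} →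
            nth H (All.lookup θ l1) ≡ just (nInl γ e) → InSum H ia e c →
            nth H (All.lookup θ l2) ≡ just (nInl γ' e') → InSum H ib e' c' →
            MakerCorrect H θ l1 l2 (λ l1 l2 → injSum i (pair (extract ia l1) (extract ib l2))) (BuiltAt H i (nPair (a ⊗ b) c c'))
  pairMaker-correct {i = i} {ia} {ib} {H} l1 l2 ef ui ef' ui' θ' l1' l2' H' ex e1 e2
    with extract-correct ia l1' (subst (λ z → nth H' z ≡ _) (sym e1) (nth-⊑ ex ef)) (inSum-⊑ ex ui)
       | extract-correct ib l2' (subst (λ z → nth H' z ≡ _) (sym e2) (nth-⊑ ex ef')) (inSum-⊑ ex ui')
  ... | m , dx | m' , dx' with injSum-correct i _ (ePair dx dx')
  ... | H2 , p2 , m2 , d2 , ex2 , ui2 , ex3 = H2 , p2 , m2 , d2 , ex2 , length H' , ui2 , nth-⊑ ex3 (nth-alloc H' _) , ⊑-length ex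

  conMaker-correct : ∀ {Δ P w} {i : μ P w ∈ S} {ic : (P ⟦ μ P w ⟧) ∈ S} {H θ} (l1 l2 : Lookup ∈ Δ) {γ e c} →
            nth H (All.lookup θ l1) ≡ just (nInl γ e) → InSum H ic e c →
            MakerCorrect H θ l1 l2 (λ l1 l2 → injSum i (con P w (extract ic l1))) (BuiltAt H i (nCon (μ P w) c))
  conMaker-correct {i = i} {ic} {H} l1 l2 ef ui θ' l1' l2' H' ex e1 e2
    with extract-correct ic l1' (subst (λ z → nth H' z ≡ _) (sym e1) (nth-⊑ ex ef)) (inSum-⊑ ex ui)
  ... | m , dx with injSum-correct i _ (eCon dx)
  ... | H2 , p2 , m2 , d2 , ex2 , ui2 , ex3 = H2 , p2 , m2 , d2 , ex2 , length H' , ui2 , nth-⊑ ex3 (nth-alloc H' _) , ⊑-length ex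

  buildVertex-unit : ∀ {Δ} (vx : vertexT ∈ Δ) (l1 l2 : Lookup ∈ Δ) {H θ} {i : unit ∈ S} → find∈ unit S ≡ just i →
                DecVertex H (All.lookup θ vx) vUnit → EvalsTo H θ (buildVertex vx l1 l2) (BuiltAt H i nUnit)
  buildVertex-unit vx l1 l2 {H} {θ} {i} ci (dVUnit e1 e2) = go ci
    where
    go : find∈ unit S ≡ just i → EvalsTo H θ (buildVertex vx l1 l2) (BuiltAt H i nUnit)
    go ce with find∈ unit S
    go refl | just .i with injSum-correct i ⟨⟩ {θ = _ ∷ θ} (eUnit {H = H})
    ... | H2 , p2 , m2 , d2 , ex2 , ui2 , ex3 = H2 , p2 , _ , eCaseL (eDes eVar e1) e2 d2 , ex2 , length H , ui2 , nth-⊑ ex3 (nth-alloc H _) , ≤-refl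

  buildVertex-inl : ∀ {Δ} (vx : vertexT ∈ Δ) (l1 l2 : Lookup ∈ Δ) {H θ τ0 n} (mk0 : Maker) (P : Heap → ℕ → Set) →
               DecVertex H (All.lookup θ vx) (vInl (enc τ0) n) → τ0 ∈ S → inlMaker τ0 ≡ just mk0 → MakerCorrect H θ l1 l2 mk0 P →
               EvalsTo H θ (buildVertex vx l1 l2) P
  buildVertex-inl vx l1 l2 mk0 P (dVInl e1 e2 e3 (dSN eS ds dn)) mem ei ok
    with dispatch-correct inlMaker S (here refl) (there (there (there l1))) (there (there (there l2))) mk0 P ds mem ei ok
  ... | H2 , p2 , m2 , d2 , ex2 , pp = H2 , p2 , _ , eCaseR (eDes eVar e1) e2 (eCaseL eVar e3 (eApp (eFst eVar eS) d2)) , ex2 , pp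

  buildVertex-inr : ∀ {Δ} (vx : vertexT ∈ Δ) (l1 l2 : Lookup ∈ Δ) {H θ τ0 n} (mk0 : Maker) (P : Heap → ℕ → Set) →
               DecVertex H (All.lookup θ vx) (vInr (enc τ0) n) → τ0 ∈ S → inrMaker τ0 ≡ just mk0 → MakerCorrect H θ l1 l2 mk0 P →
               EvalsTo H θ (buildVertex vx l1 l2) P
  buildVertex-inr vx l1 l2 mk0 P (dVInr e1 e2 e3 e4 (dSN eS ds dn)) mem ei ok
    with dispatch-correct inrMaker S (here refl) (there (there (there (there l1)))) (there (there (there (there l2)))) mk0 P ds mem ei ok
  ... | H2 , p2 , m2 , d2 , ex2 , pp = H2 , p2 , _ , eCaseR (eDes eVar e1) e2 (eCaseR eVar e3 (eCaseL eVar e4 (eApp (eFst eVar eS) d2))) , ex2 , pp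

  buildVertex-pair : ∀ {Δ} (vx : vertexT ∈ Δ) (l1 l2 : Lookup ∈ Δ) {H θ τ0 n1 n2} (mk0 : Maker) (P : Heap → ℕ → Set) →
               DecVertex H (All.lookup θ vx) (vPair (enc τ0) n1 n2) → τ0 ∈ S → pairMaker τ0 ≡ just mk0 → MakerCorrect H θ l1 l2 mk0 P →
               EvalsTo H θ (buildVertex vx l1 l2) P
  buildVertex-pair vx l1 l2 mk0 P (dVPair e1 e2 e3 e4 e5 e6 e7 ds dn1 dn2) mem ei ok
    with dispatch-correct pairMaker S (here refl) (there (there (there (there (there l1))))) (there (there (there (there (there l2))))) mk0 P ds mem ei ok
  ... | H2 , p2 , m2 , d2 , ex2 , pp = H2 , p2 , _ , eCaseR (eDes eVar e1) e2 (eCaseR eVar e3 (eCaseR eVar e4 (eCaseL eVar e5 (eApp (eFst eVar e6) d2)))) , ex2 , pp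

  buildVertex-con : ∀ {Δ} (vx : vertexT ∈ Δ) (l1 l2 : Lookup ∈ Δ) {H θ τ0 n} (mk0 : Maker) (P : Heap → ℕ → Set) →
               DecVertex H (All.lookup θ vx) (vMu (enc τ0) n) → τ0 ∈ S → conMaker τ0 ≡ just mk0 → MakerCorrect H θ l1 l2 mk0 P →
               EvalsTo H θ (buildVertex vx l1 l2) P
  buildVertex-con vx l1 l2 mk0 P (dVMu e1 e2 e3 e4 e5 (dSN eS ds dn)) mem ei ok
    with dispatch-correct conMaker S (here refl) (there (there (there (there (there l1))))) (there (there (there (there (there l2))))) mk0 P ds mem ei ok
  ... | H2 , p2 , m2 , d2 , ex2 , pp = H2 , p2 , _ , eCaseR (eDes eVar e1) e2 (eCaseR eVar e3 (eCaseR eVar e4 (eCaseR eVar e5 (eApp (eFst eVar eS) d2)))) , ex2 , pp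

  address₁ address₂ : Item → ℕ
  address₁ vUnit = 0
  address₁ (vInl s n) = n
  address₁ (vInr s n) = n
  address₁ (vPair s n1 n2) = n1
  address₁ (vMu s n) = n
  address₂ (vPair s n1 n2) = n2
  address₂ _ = 0

  zeroTm-correct : ∀ {Γ} {H : Heap} {θ : Env Γ} → EvalsTo H θ zeroTm (λ H' p → DecNat H' p 0)
  zeroTm-correct {H = H} = _ , _ , _ , eCon (eInl eUnit) , ⊑-alloc₃ , dZero (nth-alloc (alloc (alloc H nUnit) (nInl (unit ⊕ natT) (length H))) _) (nth-alloc₁ (alloc H nUnit) _ _)

  firstAddress-correct : ∀ {Δ} (vx : vertexT ∈ Δ) {H θ it} → DecVertex H (All.lookup θ vx) it → EvalsTo H θ (firstAddress vx) (λ H' p → DecNat H' p (address₁ it))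
  firstAddress-correct vx (dVUnit e1 e2) with zeroTm-correct
  ... | H2 , p2 , m2 , d2 , ex , dn = H2 , p2 , _ , eCaseL (eDes eVar e1) e2 d2 , ex , dn
  firstAddress-correct vx {H} (dVInl e1 e2 e3 (dSN eS ds dn)) = H , _ , _ , eCaseR (eDes eVar e1) e2 (eCaseL eVar e3 (eSnd eVar eS)) , ⊑-refl , dn
  firstAddress-correct vx {H} (dVInr e1 e2 e3 e4 (dSN eS ds dn)) = H , _ , _ , eCaseR (eDes eVar e1) e2 (eCaseR eVar e3 (eCaseL eVar e4 (eSnd eVar eS))) , ⊑-refl , dn
  firstAddress-correct vx {H} (dVPair e1 e2 e3 e4 e5 e6 e7 ds dn1 dn2) = H , _ , _ , eCaseR (eDes eVar e1) e2 (eCaseR eVar e3 (eCaseR eVar e4 (eCaseL eVar e5 (eFst (eSnd eVar e6) e7)))) , ⊑-refl , dn1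
  firstAddress-correct vx {H} (dVMu e1 e2 e3 e4 e5 (dSN eS ds dn)) = H , _ , _ , eCaseR (eDes eVar e1) e2 (eCaseR eVar e3 (eCaseR eVar e4 (eCaseR eVar e5 (eSnd eVar eS)))) , ⊑-refl , dn

  secondAddress-correct : ∀ {Δ} (vx : vertexT ∈ Δ) {H θ it} → DecVertex H (All.lookup θ vx) it → EvalsTo H θ (secondAddress vx) (λ H' p → DecNat H' p (address₂ it))
  secondAddress-correct vx (dVUnit e1 e2) with zeroTm-correct
  ... | H2 , p2 , m2 , d2 , ex , dn = H2 , p2 , _ , eCaseL (eDes eVar e1) e2 d2 , ex , dn
  secondAddress-correct vx {H} (dVInl e1 e2 e3 (dSN eS ds dn)) with zeroTm-correct
  ... | H2 , p2 , m2 , d2 , ex , dn' = H2 , p2 , _ , eCaseR (eDes eVar e1) e2 (eCaseL eVar e3 d2) , ex , dn'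
  secondAddress-correct vx {H} (dVInr e1 e2 e3 e4 (dSN eS ds dn)) with zeroTm-correct
  ... | H2 , p2 , m2 , d2 , ex , dn' = H2 , p2 , _ , eCaseR (eDes eVar e1) e2 (eCaseR eVar e3 (eCaseL eVar e4 d2)) , ex , dn'
  secondAddress-correct vx {H} (dVPair e1 e2 e3 e4 e5 e6 e7 ds dn1 dn2) = H , _ , _ , eCaseR (eDes eVar e1) e2 (eCaseR eVar e3 (eCaseR eVar e4 (eCaseL eVar e5 (eSnd (eSnd eVar e6) e7)))) , ⊑-refl , dn2
  secondAddress-correct vx {H} (dVMu e1 e2 e3 e4 e5 (dSN eS ds dn)) with zeroTm-correct
  ... | H2 , p2 , m2 , d2 , ex , dn' = H2 , p2 , _ , eCaseR (eDes eVar e1) e2 (eCaseR eVar e3 (eCaseR eVar e4 (eCaseR eVar e5 d2))) , ex , dn'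

update : (ℕ → ℕ) → ℕ → ℕ → ℕ → ℕ
update β j b a with a ≟ j
... | yes _ = b
... | no _ = β a

update-same : ∀ β j b → update β j b j ≡ b
update-same β j b with j ≟ j
... | yes _ = refl
... | no ne = ⊥-elim (ne refl)

update-other : ∀ β j b a → a ≢ j → update β j b a ≡ β a
update-other β j b a ne with a ≟ j
... | yes e = ⊥-elim (ne e)
... | no _ = refl

nodeMap-cong : ∀ {f g x y} → NodeMap f x y → (∀ n → x ≡ just n → ∀ c → c ∈ children n → f c ≡ g c) → NodeMap g x y
nodeMap-cong {f} {g} {just n} nm h = nodeMap-intro (trans (nodeMap-just nm) (cong just (mapNode-cong n (h n refl))))
nodeMap-cong {x = nothing} () h

itemAt-suffix : ∀ (L pre : List Item) i rest → L ≡ pre ++ i ∷ rest → itemAt L (length rest) ≡ just i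
itemAt-suffix L pre i rest refl =
  subst (λ z → nth z (length rest) ≡ just i) (sym (reverse-++ pre (i ∷ rest))) (nth-++ (reverse (i ∷ rest)) (reverse pre) (nth-reverse-last i rest))

module Correctness (S : List Ty) (closed : ∀ {τ x} → τ ∈ S → x ∈ childTypes τ → x ∈ S)
              (γ : Ty) (γ∈ : γ ∈ S)
              (Hv : Heap) (pv : ℕ) (wt : WT Hv pv γ)
              (HL : Heap) (pL : ℕ) (L : List Item) (φ : ℕ → ℕ)
              (φinj : ∀ q q' → Reach Hv pv q → Reach Hv pv q' → φ q ≡ φ q' → q ≡ q')
              (φsurj : ∀ a → a < length L → Σ ℕ λ q → Reach Hv pv q × φ q ≡ a)
              (corr : ∀ q → Reach Hv pv q → Corr φ (nth Hv q) (itemAt L (φ q)))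
              (topo : ∀ q n c → Reach Hv pv q → nth Hv q ≡ just n → c ∈ children n → φ c < φ q)
  where
  open Deserializer S
  open LookupCorrect S
  open DispatchCorrect S
  open BuildCorrect S

  reach-typed : ∀ q → Reach Hv pv q → Σ Ty λ τ → WT Hv q τ × τ ∈ S
  reach-typed q root = γ , wt , γ∈
  reach-typed q (step r e c∈) with reach-typed _ r
  ... | τ0 , w0 , m0 with WT-child w0 e c∈
  ... | x , w , k = x , w , closed m0 k

  Decoded : Heap → List ℕ → (ℕ → ℕ) → ℕ → Set
  Decoded H es β q = Σ Ty λ τ → WT Hv q τ × Σ (τ ∈ S) λ i → find∈ τ S ≡ just i × Σ ℕ λ e →
                  nth (reverse es) (φ q) ≡ just e × InSum H i e (β (φ q)) × NodeMap (λ z → β (φ z)) (nth Hv q) (nth H (β (φ q)))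

  record TableInv (H : Heap) (r : ℕ) (j : ℕ) : Set where
    field
      es : List ℕ
      acc : DecTable H r es
      len : length es ≡ j
      β : ℕ → ℕ
      good : ∀ q → Reach Hv pv q → φ q < j → Decoded H es β q
      mono : ∀ a a' → a < a' → a' < j → β a < β a'
      bnd : ∀ a → a < j → β a < length H

  TableFoldsTo : ℕ → ℕ → Set
  TableFoldsTo p j = Σ Heap λ H' → Σ ℕ λ r → Σ ℕ λ m →
    FoldEval {vtg ∷ []} (pL ∷ []) vtgP tableStep HL p H' r m × HL ⊑ H' × TableInv H' r j

  tableInv-extend : ∀ {H1 r' j H8 r pb bn qj n τ} {i : τ ∈ S} → (inv : TableInv H1 r' j) → H1 ⊑ H8 →
              DecTable H8 r (pb ∷ TableInv.es inv) → InSum H8 i pb bn → nth H8 bn ≡ just (mapNode (λ z → TableInv.β inv (φ z)) n) →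
              nth Hv qj ≡ just n → WT Hv qj τ → find∈ τ S ≡ just i → Reach Hv pv qj → φ qj ≡ j → length H1 ≤ bn →
              TableInv H8 r (suc j)
  tableInv-extend {H1} {r'} {j} {H8} {r} {pb} {bn} {qj} {n} {τ} {i} inv ex ac ui ebn eqj wq ci rqj φj lb = record
    { es = pb ∷ es
    ; acc = ac
    ; len = cong suc len
    ; β = β'
    ; good = good'
    ; mono = mono'
    ; bnd = bnd'
    }
    where
    open TableInv inv
    β' = update β j bn
    good' : ∀ q → Reach Hv pv q → φ q < suc j → Decoded H8 (pb ∷ es) β' q
    good' q rq lt with m≤n⇒m<n∨m≡n (≤-pred lt)
    ... | inj₂ e with φinj q qj rq rqj (trans e (sym φj))
    ... | refl = τ , wq , i , ci , pb ,
                 subst (λ z → nth (reverse (pb ∷ es)) z ≡ just pb) (trans len (sym e)) (nth-reverse-last pb es) ,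
                 subst (λ z → InSum H8 i pb z) (sym (trans (cong β' e) (update-same β j bn))) ui ,
                 subst (λ z → NodeMap (λ z₁ → β' (φ z₁)) (nth Hv q) (nth H8 z)) (sym (trans (cong β' e) (update-same β j bn)))
                   (subst (λ z → NodeMap (λ z₁ → β' (φ z₁)) z (nth H8 bn)) (sym eqj)
                     (nodeMap-intro (trans ebn (cong just (mapNode-cong n (λ c c∈ →
                        sym (update-other β j bn (φ c) (λ ec → <-irrefl ec (subst (φ c <_) e (topo q n c rq eqj c∈))))))))))
    good' q rq lt | inj₁ lt2 with good q rq lt2
    ... | τ' , w' , i' , ci' , e' , ne' , ui' , nm' =
          τ' , w' , i' , ci' , e' , nth-reverse-∷ pb es ne' ,
          subst (λ z → InSum H8 i' e' z) (sym (update-other β j bn (φ q) (<⇒≢ lt2))) (inSum-⊑ ex ui') ,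
          subst (λ z → NodeMap (λ z₁ → β' (φ z₁)) (nth Hv q) (nth H8 z)) (sym (update-other β j bn (φ q) (<⇒≢ lt2)))
            (nodeMap-cong (nodeMap-⊑ ex nm') (λ n' en c c∈ → sym (update-other β j bn (φ c)
               (λ ec → <-irrefl ec (<-trans (topo q n' c rq en c∈) lt2)))))
    mono' : ∀ a a' → a < a' → a' < suc j → β' a < β' a'
    mono' a a' lt lt' with m≤n⇒m<n∨m≡n (≤-pred lt')
    ... | inj₂ refl = subst₂ _<_ (sym (update-other β j bn a (<⇒≢ lt))) (sym (update-same β j bn)) (<-≤-trans (bnd a lt) lb)
    ... | inj₁ lt2 = subst₂ _<_ (sym (update-other β j bn a (<⇒≢ (<-trans lt lt2)))) (sym (update-other β j bn a' (<⇒≢ lt2)))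
                    (mono a a' lt lt2)
    bnd' : ∀ a → a < suc j → β' a < length H8
    bnd' a lt with m≤n⇒m<n∨m≡n (≤-pred lt)
    ... | inj₂ refl = subst (_< length H8) (sym (update-same β j bn)) (nth-< H8 ebn)
    ... | inj₁ lt2 = subst (_< length H8) (sym (update-other β j bn a (<⇒≢ lt2))) (<-≤-trans (bnd a lt2) (⊑-length ex))

  lookFound : ∀ {H p m e} → LookupResult H p m → m ≡ just e → Σ Ty λ g → nth H p ≡ just (nInl g e)
  lookFound (lrFound e) refl = _ , e

  child-found : ∀ {H1 r' j} (inv : TableInv H1 r' j) {H4 pl qj n c τc} → H1 ⊑ H4 →
    Reach Hv pv qj → φ qj ≡ j → nth Hv qj ≡ just n → c ∈ children n → WT Hv c τc →
    LookupResult H4 pl (nth (reverse (TableInv.es inv)) (φ c)) →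
    Σ (τc ∈ S) λ ic → find∈ τc S ≡ just ic ×
      Σ Ty λ g → Σ ℕ λ e → nth H4 pl ≡ just (nInl g e) × InSum H4 ic e (TableInv.β inv (φ c))
  child-found inv {c = c} ex rqj φj eqn c∈ wc lr
    with TableInv.good inv c (step rqj eqn c∈) (subst (φ c <_) φj (topo _ _ c rqj eqn c∈))
  ... | _ , wc' , ic , cic , e , ne , ui , _ with WT-unique wc' wc
  ... | refl = let g , ef = lookFound lr ne in ic , cic , g , e , ef , inSum-⊑ ex ui

  BuiltVertex : ∀ {Δ} → Heap → Env Δ → Tm Δ Univ → (ℕ → ℕ) → ℕ → Set
  BuiltVertex {Δ} H4 θ t β qj = Σ Ty λ τ → WT Hv qj τ × Σ (τ ∈ S) λ i → find∈ τ S ≡ just i × Σ Node λ n → nth Hv qj ≡ just n ×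
                             EvalsTo H4 θ t (BuiltAt H4 i (mapNode (λ z → β (φ z)) n))

  buildVertex-correct : ∀ {H1 r' j} (inv : TableInv H1 r' j) {Δ} (vx : vertexT ∈ Δ) (l1 l2 : Lookup ∈ Δ) {H4 θ it qj} → H1 ⊑ H4 →
              DecVertex H4 (All.lookup θ vx) it →
              LookupResult H4 (All.lookup θ l1) (nth (reverse (TableInv.es inv)) (address₁ it)) →
              LookupResult H4 (All.lookup θ l2) (nth (reverse (TableInv.es inv)) (address₂ it)) →
              Reach Hv pv qj → φ qj ≡ j → (mn : Maybe Node) → nth Hv qj ≡ mn → Corr φ mn (just it) →
              BuiltVertex H4 θ (buildVertex vx l1 l2) (TableInv.β inv) qj
  buildVertex-correct inv vx l1 l2 {H4} {θ} {it} {qj} ex dv lr1 lr2 rqj φj (just n) eqn cor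
    with reach-typed qj rqj
  ... | τ , wq , mτ with find∈-complete S mτ | WT-node wq eqn | cor
  ... | i , ci | nwUnit | cUnit =
    τ , wq , i , ci , _ , eqn , buildVertex-unit vx l1 l2 ci dv
  ... | i , ci | nwInl wc | cInl =
    let ic , cic , _ , _ , ef , ui = child-found inv ex rqj φj eqn (here refl) wc lr1 in
    τ , wq , i , ci , _ , eqn ,
    buildVertex-inl vx l1 l2 _ _ dv mτ (inlMaker-≡ ci cic) (inlMaker-correct {H = H4} {θ = θ} l1 l2 ef ui)
  ... | i , ci | nwInr wc | cInr =
    let ic , cic , _ , _ , ef , ui = child-found inv ex rqj φj eqn (here refl) wc lr1 in
    τ , wq , i , ci , _ , eqn ,
    buildVertex-inr vx l1 l2 _ _ dv mτ (inrMaker-≡ ci cic) (inrMaker-correct {H = H4} {θ = θ} l1 l2 ef ui)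
  ... | i , ci | nwPair wc wd | cPair =
    let ic , cic , _ , _ , ef , ui = child-found inv ex rqj φj eqn (here refl) wc lr1
        id , cid , _ , _ , ef' , ui' = child-found inv ex rqj φj eqn (there (here refl)) wd lr2 in
    τ , wq , i , ci , _ , eqn ,
    buildVertex-pair vx l1 l2 _ _ dv mτ (pairMaker-≡ ci cic cid) (pairMaker-correct {H = H4} {θ = θ} l1 l2 ef ui ef' ui')
  ... | i , ci | nwCon wc | cCon =
    let ic , cic , _ , _ , ef , ui = child-found inv ex rqj φj eqn (here refl) wc lr1 in
    τ , wq , i , ci , _ , eqn ,
    buildVertex-con vx l1 l2 _ _ dv mτ (conMaker-≡ ci cic) (conMaker-correct {H = H4} {θ = θ} l1 l2 ef ui)

  TableStepArg : Ty
  TableStepArg = vtgP ⟦ Table ⟧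

  itemLt : ∀ {a it} → itemAt L a ≡ just it → a < length L
  itemLt {a} e = subst (a <_) (length-reverse L) (nth-< (reverse L) e)

  tableStep-cons : ∀ {p γ δ ε q u x l it rest} → nth HL p ≡ just (nCon γ q) → nth HL q ≡ just (nInr δ u) →
    nth HL u ≡ just (nPair ε x l) → DecVertex HL x it → (pre : List Item) → L ≡ pre ++ it ∷ rest →
    TableFoldsTo l (length rest) →
    TableFoldsTo p (suc (length rest))
  tableStep-cons {p = p} {x = x} {it = it} {rest = rest} e1 e2 e3 dv pre eqL (H1 , r' , m' , fd , ext1 , inv) =
    case φsurj j (itemLt iA) of λ { (qj , rqj , φj) →
    case firstAddress-correct (here refl) {H1c} {θ1} dv' of λ { (Ha , pa , ma , da , exa , dna) →
    case lookupTable-correct (there (here refl)) (firstAddress (here refl)) {H1c} {θ1} acc1 da dna of λ { (H3 , pl1 , _ , dl1 , ex3 , lr1) →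
    case secondAddress-correct (there (here refl)) {H3} {pl1 ∷ θ1} (decVertex-⊑ ex3 dv') of λ { (Hb , pb' , mb , db , exb , dnb) →
    case lookupTable-correct (there (there (here refl))) (secondAddress (there (here refl))) {H3} {pl1 ∷ θ1} (decTable-⊑ ex3 acc1) db dnb of λ { (H4 , pl2 , _ , dl2 , ex4 , lr2) →
    case buildVertex-correct inv (there (there (here refl))) (there (here refl)) (here refl) {H4} {pl2 ∷ pl1 ∷ θ1} {it} {qj}
             (⊑-trans (⊑-alloc₂ {H1}) (⊑-trans ex3 ex4)) (decVertex-⊑ ex4 (decVertex-⊑ ex3 dv')) (lookupResult-⊑ ex4 lr1) lr2 rqj φj
             (nth Hv qj) refl (subst (Corr φ (nth Hv qj)) (trans (cong (itemAt L) φj) iA) (corr qj rqj)) of λ {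
      (τ , wq , iτ , ciτ , n , eqn , H5 , pbu , mbu , dbu , ex5 , bn , ui , ebn , lb) →
      finish dl1 dl2 dbu (⊑-trans ex3 (⊑-trans ex4 ex5)) ui ebn eqn wq ciτ rqj φj (≤-trans (⊑-length (⊑-trans (⊑-alloc₂ {H1}) (⊑-trans ex3 ex4))) lb) } } } } } }
    where
    j = length rest
    iA : itemAt L j ≡ just it
    iA = itemAt-suffix L pre it rest eqL
    H1b = alloc H1 (nPair (vertexT ⊗ Table) x r')
    H1c = alloc H1b (nInr TableStepArg (length H1))
    θ1 : Env (vertexT ∷ Table ∷ (vertexT ⊗ Table) ∷ TableStepArg ∷ vtg ∷ [])
    θ1 = x ∷ r' ∷ length H1 ∷ length H1b ∷ pL ∷ []
    prE : nth H1c (length H1) ≡ just (nPair (vertexT ⊗ Table) x r')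
    prE = nth-alloc₁ H1 _ _
    dv' : DecVertex H1c x it
    dv' = decVertex-⊑ (⊑-trans ext1 (⊑-alloc₂ {H1})) dv
    acc1 : DecTable H1c r' (TableInv.es inv)
    acc1 = decTable-⊑ (⊑-alloc₂ {H1}) (TableInv.acc inv)
    finish : ∀ {H3 pl1 n1 H4 pl2 n2 H5 pbu nb bn qj n τ} {iτ : τ ∈ S} →
      Eval H1c θ1 (lookupTable (there (here refl)) (firstAddress (here refl))) H3 pl1 n1 →
      Eval H3 (pl1 ∷ θ1) (lookupTable (there (there (here refl))) (secondAddress (there (here refl)))) H4 pl2 n2 →
      Eval H4 (pl2 ∷ pl1 ∷ θ1) (buildVertex (there (there (here refl))) (there (here refl)) (here refl)) H5 pbu nb →
      H1c ⊑ H5 → InSum H5 iτ pbu bn → nth H5 bn ≡ just (mapNode (λ z → TableInv.β inv (φ z)) n) → nth Hv qj ≡ just n →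
      WT Hv qj τ → find∈ τ S ≡ just iτ → Reach Hv pv qj → φ qj ≡ j → length H1 ≤ bn →
      TableFoldsTo p (suc j)
    finish {H5 = H5} {pbu} dl1 dl2 dbu ex ui ebn eqn wq ciτ rqj φj lb =
      H8 , length H7 , _ ,
      fStep e1 (mInr e2 (mPair e3 mK (mId fd)))
        (eCaseR eVar (nth-alloc H1b _) (eApp (eSnd eVar prE) (eApp (eFst eVar prE) (eApp dl1 (eApp dl2 (eCon (eInr (ePair dbu eVar)))))))) ,
      ⊑-trans ext1 exH ,
      tableInv-extend inv exH
        (tCons (nth-alloc H7 _) (nth-alloc₁ H6 _ _) (nth-alloc₂ H5 _ _ _) (decTable-⊑ exH (TableInv.acc inv)))
        (inSum-⊑ (⊑-alloc₃ {H5}) ui) (nth-⊑ (⊑-alloc₃ {H5}) ebn) eqn wq ciτ rqj φj lb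
      where
      H6 = alloc H5 (nPair (Univ ⊗ Table) pbu r')
      H7 = alloc H6 (nInr (unit ⊕ (Univ ⊗ Table)) (length H5))
      H8 = alloc H7 (nCon Table (length H6))
      exH : H1 ⊑ H8
      exH = ⊑-trans (⊑-alloc₂ {H1}) (⊑-trans ex ⊑-alloc₃)

  tableFold-correct : ∀ {p L'} → DecList HL p L' → (pre : List Item) → L ≡ pre ++ L' →
    TableFoldsTo p (length L')
  tableFold-correct (dLNil {u = u} e1 e2) pre eqL =
    H4 , length H3 , _ , fStep e1 (mInl e2 mK) (eCaseL eVar (nth-alloc HL _) (eCon (eInl eUnit))) , ⊑-trans ⊑-alloc ⊑-alloc₃ ,
    record { es = [] ; acc = tNil (nth-alloc H3 _) (nth-alloc₁ H2 _ _) ; len = refl ; β = λ a → a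
           ; good = λ q rq () ; mono = λ a a' lt () ; bnd = λ a () }
    where
    H1 = alloc HL (nInl TableStepArg u)
    H2 = alloc H1 nUnit
    H3 = alloc H2 (nInl (unit ⊕ (Univ ⊗ Table)) (length H1))
    H4 = alloc H3 (nCon Table (length H2))
  tableFold-correct (dLCons {q = q} {u = u} {x = x} {l = l} {i = it} {is = rest} e1 e2 e3 dv dlr) pre eqL =
    tableStep-cons e1 e2 e3 dv pre eqL (tableFold-correct dlr (pre ++ it ∷ []) (trans eqL (sym (++-assoc pre (it ∷ []) rest))))

  φ≤ : ∀ q → Reach Hv pv q → φ q ≤ φ pv
  φ≤ q root = ≤-refl
  φ≤ q (step {q = q0} r e c∈) = <⇒≤ (<-≤-trans (topo q0 _ q r e c∈) (φ≤ q0 r))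

  root-address : ∀ N → φ pv < N → (∀ a → a < N → Σ ℕ λ q → Reach Hv pv q × φ q ≡ a) → suc (φ pv) ≡ N
  root-address (suc N') lt surj with surj N' ≤-refl
  ... | q , rq , eq = ≤-antisym lt (s≤s (subst (_≤ φ pv) eq (φ≤ q rq)))

  module Result (φ< : ∀ q → Reach Hv pv q → φ q < length L) (dl : DecList HL pL L) where

    DeserializeResult : Set
    DeserializeResult = Σ Heap λ H' → Σ ℕ λ r → Σ ℕ λ m → Eval {vtg ∷ []} HL (pL ∷ []) (deserializeBody γ) H' r m × Iso H' r Hv pv

    module TableIso {H1 r1} (inv : TableInv H1 r1 (length L)) where
      open TableInv inv
      ψ : ℕ → ℕ
      ψ q = β (φ q)

      decoded : ∀ q → Reach Hv pv q → Decoded H1 es β q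
      decoded q rq = good q rq (φ< q rq)

      ψ-nodeMap : ∀ q → Reach Hv pv q → NodeMap ψ (nth Hv q) (nth H1 (ψ q))
      ψ-nodeMap q rq with decoded q rq
      ... | _ , _ , _ , _ , _ , _ , _ , nm = nm

      reach-image : ∀ q → Reach Hv pv q → Reach H1 (ψ pv) (ψ q)
      reach-image q root = root
      reach-image q (step {q = q0} {n = n} r e c∈) =
        step (reach-image q0 r) (nodeMap-just (subst (λ z → NodeMap ψ z (nth H1 (ψ q0))) e (ψ-nodeMap q0 r))) (children-map n c∈)

      β-inj : ∀ a a' → a < length L → a' < length L → β a ≡ β a' → a ≡ a'
      β-inj a a' h h' eq with <-cmp a a'
      ... | tri< lt _ _ = ⊥-elim (<-irrefl eq (mono a a' lt h'))
      ... | tri≈ _ e _ = e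
      ... | tri> _ _ gt = ⊥-elim (<-irrefl (sym eq) (mono a' a gt h))

      reach-preimage : ∀ x → Reach H1 (ψ pv) x → Σ ℕ λ q → Reach Hv pv q × ψ q ≡ x
      reach-preimage x root = pv , root , refl
      reach-preimage x (step {q = x0} {n = n'} rx e' c'∈) with reach-preimage x0 rx
      ... | q0 , rq0 , refl = go (nth Hv q0) refl (ψ-nodeMap q0 rq0)
        where
        go : (mn : Maybe Node) → nth Hv q0 ≡ mn → NodeMap ψ mn (nth H1 (ψ q0)) → Σ ℕ λ q → Reach Hv pv q × ψ q ≡ x
        go nothing eq ()
        go (just n) eq nm with trans (sym (nodeMap-just nm)) e'
        ... | refl with children-unmap n c'∈
        ... | c , c∈ , ec = c , step rq0 eq c∈ , ec

      preimage : (N x : ℕ) → Maybe (Σ ℕ λ a → a < N × β a ≡ x)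
      preimage zero x = nothing
      preimage (suc N) x with β N ≟ x
      ... | yes e = just (N , ≤-refl , e)
      ... | no _ = Maybe.map (λ { (a , lt , e) → a , m≤n⇒m≤1+n lt , e }) (preimage N x)

      preimage-none : ∀ N x → preimage N x ≡ nothing → ∀ a → a < N → β a ≢ x
      preimage-none (suc N) x eq a lt e' with β N ≟ x
      preimage-none (suc N) x () a lt e' | yes e
      ... | no ne with preimage N x in eq2
      ... | nothing with m≤n⇒m<n∨m≡n (≤-pred lt)
      ... | inj₁ lt2 = preimage-none N x eq2 a lt2 e'
      ... | inj₂ refl = ne e'
      preimage-none (suc N) x () a lt e' | no ne | just _

      χ : ℕ → ℕ
      χ x with preimage (length L) x
      ... | just (a , lt , _) = proj₁ (φsurj a lt)
      ... | nothing = 0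

      χψ : ∀ q → Reach Hv pv q → χ (ψ q) ≡ q
      χψ q rq with preimage (length L) (ψ q) in eq
      ... | nothing = ⊥-elim (preimage-none (length L) (ψ q) eq (φ q) (φ< q rq) refl)
      ... | just (a , lt , e) with φsurj a lt
      ... | q' , rq' , eφ = φinj q' q rq' rq (trans eφ (β-inj a (φ q) lt (φ< q rq) e))

      mapNode-comp : ∀ f g n → mapNode f (mapNode g n) ≡ mapNode (λ z → f (g z)) n
      mapNode-comp f g nUnit = refl
      mapNode-comp f g (nInl x x₁) = refl
      mapNode-comp f g (nInr x x₁) = refl
      mapNode-comp f g (nPair x x₁ x₂) = refl
      mapNode-comp f g (nCon x x₁) = refl

      mapNode-id : ∀ n → mapNode (λ z → z) n ≡ n
      mapNode-id nUnit = refl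
      mapNode-id (nInl x x₁) = refl
      mapNode-id (nInr x x₁) = refl
      mapNode-id (nPair x x₁ x₂) = refl
      mapNode-id (nCon x x₁) = refl

      χ-nodeMap : ∀ q → Reach Hv pv q → NodeMap χ (nth H1 (ψ q)) (nth Hv (χ (ψ q)))
      χ-nodeMap q rq = subst (λ z → NodeMap χ (nth H1 (ψ q)) (nth Hv z)) (sym (χψ q rq)) (go (nth Hv q) refl (ψ-nodeMap q rq))
        where
        go : (mn : Maybe Node) → nth Hv q ≡ mn → NodeMap ψ mn (nth H1 (ψ q)) → NodeMap χ (nth H1 (ψ q)) mn
        go nothing eq ()
        go (just n) eq nm = subst (λ z → NodeMap χ z (just n)) (sym (nodeMap-just nm))
          (nodeMap-intro (cong just (sym (trans (mapNode-comp χ ψ n) (trans (mapNode-cong n (λ c c∈ → χψ c (step rq eq c∈))) (mapNode-id n))))))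

      iso : Iso H1 (ψ pv) Hv pv
      iso = χ , χψ pv root ,
            (λ x rx → let (q , rq , e) = reach-preimage x rx in subst (λ z → Reach Hv pv (χ z)) e (subst (Reach Hv pv) (sym (χψ q rq)) rq)) ,
            (λ x x' rx rx' eq → let (q , rq , e) = reach-preimage x rx ; (q' , rq' , e') = reach-preimage x' rx' in
                 trans (sym e) (trans (cong ψ (trans (sym (χψ q rq)) (trans (cong χ e) (trans eq (trans (cong χ (sym e')) (χψ q' rq')))))) e')) ,
            (λ r rr → ψ r , reach-image r rr , χψ r rr) ,
            (λ x rx → let (q , rq , e) = reach-preimage x rx in subst (λ z → NodeMap χ (nth H1 z) (nth Hv (χ z))) e (χ-nodeMap q rq))

    inSum-retype : ∀ {H e b τ} (i' : τ ∈ S) (iγ : γ ∈ S) → τ ≡ γ → find∈ τ S ≡ just i' → find∈ γ S ≡ just iγ → InSum H i' e b → InSum H iγ e b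
    inSum-retype i' iγ refl c1 c2 u with trans (sym c1) c2
    ... | refl = u

    readRoot-correct : ∀ {H1 r1 etop es' b} (iγ : γ ∈ S) → (mi : Maybe (γ ∈ S)) → mi ≡ just iγ → DecTable H1 r1 (etop ∷ es') → InSum H1 iγ etop b →
             Σ ℕ λ mh → Eval {Table ∷ vtg ∷ []} H1 (r1 ∷ pL ∷ []) (readRoot γ mi) H1 b mh
    readRoot-correct iγ .(just iγ) refl (tCons ea eb ec _) ui with projSum-correct S iγ (here refl) {θ = _ ∷ _ ∷ _ ∷ pL ∷ []} ui
    ... | mx , dx = _ , eCaseR (eDes eVar ea) eb (eApp (eFst eVar ec) dx)

    deserializeBody-from-table : TableFoldsTo pL (length L) →
               (Σ (γ ∈ S) λ iγ → find∈ γ S ≡ just iγ) → DeserializeResult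
    deserializeBody-from-table (H1 , r1 , m , fd , ext , inv) (iγ , ciγ) = go (TableInv.es inv) refl
      where
      open TableInv inv
      go : ∀ xs → xs ≡ es → DeserializeResult
      go [] eq = ⊥-elim (n≮0 (<-≤-trans (φ< pv root) (≤-reflexive (trans (sym len) (cong length (sym eq))))))
      go (etop ∷ es') eq = case good pv root (φ< pv root) of λ { (τ , w , i' , ci' , e , ne , ui , nm) →
          H1 , β (φ pv) , _ ,
          eApp (eFold eVar fd) (proj₂ (readRoot-correct iγ (find∈ γ S) ciγ (subst (DecTable H1 r1) (sym eq) acc)
                 (inSum-retype i' iγ (WT-unique w wt) ci' ciγ (subst (λ z → InSum H1 i' z (β (φ pv))) (e≡ e ne) ui)))) ,
          TableIso.iso inv }
        where
        φpv : φ pv ≡ length es'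
        φpv = suc-injective (trans (root-address (length L) (φ< pv root) φsurj) (trans (sym len) (cong length (sym eq))))
        e≡ : ∀ e → nth (reverse es) (φ pv) ≡ just e → e ≡ etop
        e≡ e ne = just-injective (trans (sym ne) (subst (λ z → nth (reverse es) z ≡ just etop) (sym φpv)
                (subst (λ z → nth (reverse z) (length es') ≡ just etop) eq (nth-reverse-last etop es'))))

    deserializeBody-correct : DeserializeResult
    deserializeBody-correct = deserializeBody-from-table (tableFold-correct dl [] refl) (find∈-complete S γ∈)

deserialize : (γ : Ty) → Fun [] vtg γ
deserialize γ = Deserializer.deserialize (vertexTypes γ) γ

deserialize-TDPolyCost : (γ : Ty) → TDPolyCost (deserialize γ)
deserialize-TDPolyCost γ = Cost.deserialize-cost (vertexTypes γ) γ

deserialize-correct : ∀ γ {Γ} (e : Tm Γ vtg) {H θ HL pL n} → Eval H θ e HL pL n →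
  ∀ {Hv pv} → WT Hv pv γ → Represents HL pL Hv pv →
  Σ Heap λ H' → Σ ℕ λ r → Σ ℕ λ m → Eval H θ (app (wkFun (deserialize γ)) e) H' r m × Iso H' r Hv pv
deserialize-correct γ e {HL = HL} {pL} de {Hv} {pv} wt (L , dl , φ , φ< , φinj , φsurj , corr , topo) =
  let H' , r , m , d , iso = Correctness.Result.deserializeBody-correct (vertexTypes γ) (vertexTypes-closed γ) γ
                               (vertexTypes-self γ) Hv pv wt HL pL L φ φinj φsurj corr topo φ< dl
  in H' , r , _ , eApp de (eval-ren (RenEnv-ext pL (λ ())) {t = Deserializer.deserializeBody (vertexTypes γ) γ} d) , iso

lemma16 : (γ : Ty) → Σ (Fun [] vtg γ) λ deserialize → TDPolyCost deserialize
    × (∀ {Γ} (e : Tm Γ vtg) (H : Heap) (θ : Env Γ) → EnvWT H θ →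
    ∀ HL pL n → Eval H θ e HL pL n →
    ∀ Hv pv → WT Hv pv γ → Represents HL pL Hv pv →
    Σ Heap λ H' → Σ ℕ λ r → Σ ℕ λ m →
    Eval H θ (app (wkFun deserialize) e) H' r m × Iso H' r Hv pv)
lemma16 γ = deserialize γ , deserialize-TDPolyCost γ ,
  λ e H θ _ HL pL n de Hv pv wt rep → deserialize-correct γ e de wt rep
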